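{- Let $p<q<r$ be primes. The independent domination polynomial of the zero divisor graph $\Gamma(\mathbb{Z}_{pqr})$ is never unimodal, and it is log-concave if and only if $|\phi(pq)-\phi(r)|\neq 2$, where $\phi$ is Euler's totient function.
   Context: For a commutative ring $R$ with identity, the zero divisor graph $\Gamma(R)$ is the simple graph whose vertices are the nonzero zero divisors of $R$, two distinct vertices $a,b$ being adjacent iff $ab=0$. For a graph $G$, a set $S\subseteq V(G)$ is an independent dominating set if its vertices are pairwise non-adjacent and every vertex outside $S$ is adjacent to some vertex of $S$. Let $d_i(G,k)$ be the number of independent dominating sets of size $k$; the independent domination polynomial is $D_i(G,x)=\sum_{k} d_i(G,k)x^k$. A polynomial $\sum_{i=0}^{b}a_ix^i$ of degree $b$ is unimodal if there is an index $t$ with $a_0\le a_1\le\dots\le a_t\ge a_{t+1}\ge\dots\ge a_b$, and log-concave if $a_j^2\ge a_{j-1}a_{j+1}$ for all $1\le j\le b-1$. -}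

module Defs where

open import Data.Nat using (ℕ; zero; suc; _+_; _*_; _∸_; _≤_; _<_; _≥_)
open import Data.Nat.Properties using (_≟_)
open import Data.Nat.Divisibility using (_∣_; _∣?_)
open import Data.Nat.GCD using (gcd)
open import Data.Fin using (Fin; toℕ)
import Data.Fin.Properties as FinP
open import Data.Fin.Subset using (Subset; _∈_; _∉_; ∣_∣; inside; outside)
open import Data.Fin.Subset.Properties using (_∈?_)
open import Data.Vec using (_∷_; [])
open import Data.List using (List; []; _∷_; map; _++_; filter; length; upTo)
open import Data.Product using (_×_; ∃; ∃-syntax; _,_)
open import Relation.Nullary using (¬_; Dec; yes; no)
open import Relation.Nullary.Decidable using (_×-dec_; _→-dec_; ¬?)
open import Relation.Binary.PropositionalEquality using (_≡_; _≢_)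

φ : ℕ → ℕ
φ n = length (filter (λ k → gcd k n ≟ 1) (map suc (upTo n)))

-- The zero divisor graph Γ(ℤ_n).  Elements of ℤ_n are represented by
-- their canonical residues a ∈ {0,…,n-1} (i.e. a : Fin n); the product
-- a·b is 0 in ℤ_n iff n ∣ a * b.

module ZeroDivisorGraph (n : ℕ) where

  MulZero : Fin n → Fin n → Set
  MulZero a b = n ∣ toℕ a * toℕ b

  IsVertex : Fin n → Set
  IsVertex a = toℕ a ≢ 0 × ∃[ b ] (toℕ b ≢ 0 × MulZero a b)

  Adj : Fin n → Fin n → Set
  Adj a b = IsVertex a × IsVertex b × a ≢ b × MulZero a b

  IsIndependentDominating : Subset n → Set
  IsIndependentDominating S =
      (∀ a → a ∈ S → IsVertex a)
    × (∀ a b → a ∈ S → b ∈ S → ¬ Adj a b)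
    × (∀ a → IsVertex a → a ∉ S → ∃[ b ] (b ∈ S × Adj a b))

  mulZero? : ∀ a b → Dec (MulZero a b)
  mulZero? a b = n ∣? (toℕ a * toℕ b)

  isVertex? : ∀ a → Dec (IsVertex a)
  isVertex? a = ¬? (toℕ a ≟ 0) ×-dec FinP.any? (λ b → ¬? (toℕ b ≟ 0) ×-dec mulZero? a b)

  adj? : ∀ a b → Dec (Adj a b)
  adj? a b = isVertex? a ×-dec isVertex? b ×-dec ¬? (a FinP.≟ b) ×-dec mulZero? a b

  isIndependentDominating? : ∀ S → Dec (IsIndependentDominating S)
  isIndependentDominating? S =
        FinP.all? (λ a → (a ∈? S) →-dec isVertex? a)
    ×-dec FinP.all? (λ a → FinP.all? (λ b → (a ∈? S) →-dec ((b ∈? S) →-dec ¬? (adj? a b))))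
    ×-dec FinP.all? (λ a → isVertex? a →-dec (¬? (a ∈? S) →-dec
                      FinP.any? (λ b → (b ∈? S) ×-dec adj? a b)))

allSubsets : (m : ℕ) → List (Subset m)
allSubsets zero    = [] ∷ []
allSubsets (suc m) = map (inside ∷_) (allSubsets m) ++ map (outside ∷_) (allSubsets m)

-- d_i(Γ(ℤ_n), k): the number of independent dominating sets of size k.
-- The independent domination polynomial D_i(Γ(ℤ_n), x) is represented
-- by its coefficient function k ↦ d_i(Γ(ℤ_n), k).

indDomCoeff : (n : ℕ) → ℕ → ℕ
indDomCoeff n k =
  length (filter (λ S → ZeroDivisorGraph.isIndependentDominating? n S ×-dec (∣ S ∣ ≟ k))
                 (allSubsets n))

IsDegree : (ℕ → ℕ) → ℕ → Set
IsDegree a b = a b ≢ 0 × (∀ i → b < i → a i ≡ 0)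

Unimodal : (ℕ → ℕ) → ℕ → Set
Unimodal a b = ∃[ t ] (t ≤ b
                     × (∀ i → i < t → a i ≤ a (suc i))
                     × (∀ i → t ≤ i → i < b → a (suc i) ≤ a i))

LogConcave : (ℕ → ℕ) → ℕ → Set
LogConcave a b = ∀ j → 1 ≤ j → j ≤ b ∸ 1 → a (j ∸ 1) * a (suc j) ≤ a j * a j

-- A residue v of ℤ_pqr is a nonzero zero divisor iff its set I of prime divisors among p, q, r
-- is nonempty and proper, and u v ≡ 0 iff the two sets cover {p, q, r}.  So Γ(ℤ_pqr) is the blow-up
-- of a six-vertex graph on the classes V_I: a triangle V_pq, V_pr, V_qr with pendant vertices
-- V_r – V_pq, V_q – V_pr, V_p – V_qr, each class becoming an independent set.  Independent dominating
-- sets of a blow-up are the blow-ups of those of the small graph, and the small graph has exactly four: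
-- {V_p, V_q, V_r} and V_I ∪ {V_i : i ∈ I} for the three pairs I.  With a = φ p, b = φ q, c = φ r the
-- classes have sizes |V_p| = b c, …, |V_pq| = c, …, hence
--   D_i(Γ(ℤ_pqr), x) = x^(bc+ac+ab) + x^(bc+ac+c) + x^(bc+ab+b) + x^(ac+ab+a).
-- As 1 ≤ a < b and b + 2 ≤ c (q and r are odd primes), the smallest exponent is followed by a gap,
-- so there is an internal zero coefficient and no unimodality.  Two exponents differ by exactly 2 iff
-- |ab - c| = |φ(pq) - φ(r)| = 2.  If they do, the coefficient between them is 0 and log-concavity fails
-- there; otherwise a_(j-1) a_(j+1) = 0 for every j.
module Submission where

open import Defs
open import Data.Bool.Base using (Bool; true; false; not; _∧_; _∨_; if_then_else_; T)
open import Data.Bool.ListAction using (all; any)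
open import Data.Bool.Properties using (∧-identityʳ; ∧-zeroʳ; ∧-comm; ¬-not; T-≡; T-not-≡; T-∧)
open import Data.Empty using (⊥-elim)
open import Data.Fin.Base using (Fin; toℕ; fromℕ<)
open import Data.Fin.Properties using (toℕ<n; toℕ-fromℕ<)
open import Data.Fin.Subset using (Subset; inside; outside) renaming (_∈_ to _∈ₛ_)
import Data.Fin.Subset as Subset
open import Data.List.Base using (List; []; _∷_; _++_; map; filter; length; applyUpTo)
open import Data.List.Membership.Propositional using (_∈_; _∉_)
open import Data.List.Membership.Propositional.Properties
  using (∈-map⁺; ∈-map⁻; ∈-++⁺ˡ; ∈-++⁺ʳ; ∈-filter⁺; ∈-filter⁻)
open import Data.List.Membership.Propositional.Properties.WithK using (unique∧set⇒bag)
open import Data.List.Properties using (map-upTo; map-cong; filter-some; filter-none; filter-reject)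
open import Data.List.Relation.Binary.BagAndSetEquality using (∼bag⇒↭)
open import Data.List.Relation.Binary.Permutation.Propositional.Properties using (↭-length)
open import Data.List.Relation.Unary.All as All using (All; []; _∷_)
open import Data.List.Relation.Unary.All.Properties using (all⁺; ¬Any⇒All¬)
open import Data.List.Relation.Unary.Any as Any using (Any; here; there; satisfied)
open import Data.List.Relation.Unary.Any.Properties using (any⁻; map⁺; map⁻)
open import Data.List.Relation.Unary.Unique.Propositional using (Unique; []; _∷_)
import Data.List.Relation.Unary.Unique.Propositional.Properties as Unique
open import Data.Maybe.Base using (Maybe; just; nothing; maybe′)
open import Data.Maybe.Properties using (just-injective)
open import Data.Nat.Base
  using (ℕ; zero; suc; pred; _+_; _*_; _∸_; _≤_; _<_; z≤n; s≤s; s≤s⁻¹; ∣_-_∣; NonZero; nonTrivial⇒n>1)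
open import Data.Nat.Coprimality using (Coprime; coprime-divisor; coprime⇒gcd≡1)
import Data.Nat.Coprimality as Coprimality
open import Data.Nat.Divisibility
open import Data.Nat.GCD using (gcd; gcd[m,n]∣m; gcd[m,n]∣n; gcd-greatest)
open import Data.Nat.LCM using (lcm; lcm-least; gcd*lcm)
open import Data.Nat.ListAction using (sum)
open import Data.Nat.Primality using (Prime; prime⇒irreducible; prime⇒nonZero; prime⇒nonTrivial; euclidsLemma)
open import Data.Nat.Properties
import Algebra.Properties.CommutativeSemigroup as CommutativeSemigroupProperties
open CommutativeSemigroupProperties +-commutativeSemigroup using (interchange)
open CommutativeSemigroupProperties *-commutativeSemigroup
  using (xy∙z≈y∙xz; xy∙z≈z∙xy; xy∙z≈x∙zy; xy∙z≈y∙zx; xy∙z≈xz∙y; xy∙z≈yz∙x)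
open import Data.Nat.Solver using (module +-*-Solver)
open +-*-Solver using (solve; _:+_; _:*_; _:=_; con)
open import Data.Product using (_×_; _,_; ∃; proj₁; proj₂)
open import Data.Sum using (_⊎_; inj₁; inj₂; [_,_]′)
open import Data.Vec.Base using ([]; _∷_; lookup; tabulate)
import Data.Vec.Properties as Vec
open import Data.Vec.Properties using ([]=⇒lookup; lookup⇒[]=; lookup∘tabulate; tabulate∘lookup; tabulate-cong)
open import Function.Base using (_∘_)
open import Function.Bundles using (_⇔_; mk⇔; Equivalence)
open import Relation.Binary.PropositionalEquality
open import Relation.Nullary using (¬_; yes; no; contradiction)
open import Relation.Nullary.Decidable using (does; dec-true; dec-false; does-⇔; ¬?; _×-dec_)
open import Relation.Unary using (Decidable)

χ : Bool → ℕ
χ true  = 1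
χ false = 0

∧≡true⇔ : ∀ {a b} → a ∧ b ≡ true ⇔ (a ≡ true × b ≡ true)
∧≡true⇔ {true}  = mk⇔ (refl ,_) proj₂
∧≡true⇔ {false} = mk⇔ (λ ()) (λ ())

∨≡true⇔ : ∀ {a b} → a ∨ b ≡ true ⇔ (a ≡ true ⊎ b ≡ true)
∨≡true⇔ {true}  = mk⇔ inj₁ (λ _ → refl)
∨≡true⇔ {false} = mk⇔ inj₂ (λ { (inj₁ ()) ; (inj₂ b≡true) → b≡true })

bool-≡ : ∀ {b c : Bool} → (b ≡ true → c ≡ true) → (c ≡ true → b ≡ true) → b ≡ c
bool-≡ {true}  {true}  _ _ = refl
bool-≡ {true}  {false} f _ = sym (f refl)
bool-≡ {false} {true}  _ g = g refl
bool-≡ {false} {false} _ _ = refl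

-- Counting residues below a bound

sumBelow : ℕ → (ℕ → ℕ) → ℕ
sumBelow zero    w = 0
sumBelow (suc n) w = w 0 + sumBelow n (w ∘ suc)

sumBelow-cong : ∀ n {w w′ : ℕ → ℕ} → (∀ {v} → v < n → w v ≡ w′ v) → sumBelow n w ≡ sumBelow n w′
sumBelow-cong zero    eq = refl
sumBelow-cong (suc n) eq = cong₂ _+_ (eq (s≤s z≤n)) (sumBelow-cong n (eq ∘ s≤s))

sumBelow-zero : ∀ n → sumBelow n (λ _ → 0) ≡ 0
sumBelow-zero zero    = refl
sumBelow-zero (suc n) = sumBelow-zero n

sumBelow-+ : ∀ n (w w′ : ℕ → ℕ) → sumBelow n (λ v → w v + w′ v) ≡ sumBelow n w + sumBelow n w′
sumBelow-+ zero    w w′ = refl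
sumBelow-+ (suc n) w w′ = trans (cong (w 0 + w′ 0 +_) (sumBelow-+ n (w ∘ suc) (w′ ∘ suc)))
                                (interchange (w 0) (w′ 0) _ _)

sumBelow-split : ∀ m n (w : ℕ → ℕ) → sumBelow (m + n) w ≡ sumBelow m w + sumBelow n (w ∘ (m +_))
sumBelow-split zero    n w = refl
sumBelow-split (suc m) n w = trans (cong (w 0 +_) (sumBelow-split m n (w ∘ suc))) (sym (+-assoc (w 0) _ _))

sumBelow-sum : ∀ {A : Set} n (f : ℕ → A → ℕ) (xs : List A) →
               sumBelow n (λ v → sum (map (f v) xs)) ≡ sum (map (λ x → sumBelow n (λ v → f v x)) xs)
sumBelow-sum n f []       = sumBelow-zero n
sumBelow-sum n f (x ∷ xs) = trans (sumBelow-+ n (λ v → f v x) (λ v → sum (map (f v) xs)))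
                                  (cong (sumBelow n (λ v → f v x) +_) (sumBelow-sum n f xs))

count : ℕ → (ℕ → Bool) → ℕ
count n g = sumBelow n (χ ∘ g)

count-cong : ∀ n {g h : ℕ → Bool} → (∀ {v} → v < n → g v ≡ h v) → count n g ≡ count n h
count-cong n eq = sumBelow-cong n (cong χ ∘ eq)

count-true : ∀ n → count n (λ _ → true) ≡ n
count-true zero    = refl
count-true (suc n) = cong suc (count-true n)

count-split : ∀ n (g h : ℕ → Bool) → count n g ≡ count n (λ v → g v ∧ h v) + count n (λ v → g v ∧ not (h v))
count-split n g h = trans (sumBelow-cong n (λ {v} _ → χ-split (g v) (h v))) (sumBelow-+ n _ _)
  where
  χ-split : ∀ a b → χ a ≡ χ (a ∧ b) + χ (a ∧ not b)
  χ-split true  true  = refl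
  χ-split true  false = refl
  χ-split false b     = refl

count-complement : ∀ n (g : ℕ → Bool) → count n g + count n (not ∘ g) ≡ n
count-complement n g = trans (sym (count-split n (λ _ → true) g)) (count-true n)

count-∧-const : ∀ n (g : ℕ → Bool) b → count n (λ v → g v ∧ b) ≡ (if b then count n g else 0)
count-∧-const n g true  = count-cong n (λ {v} _ → ∧-identityʳ (g v))
count-∧-const n g false = trans (count-cong n (λ {v} _ → ∧-zeroʳ (g v))) (sumBelow-zero n)

count-rotate : ∀ n (g : ℕ → Bool) → g 0 ≡ g n → count n (g ∘ suc) ≡ count n g
count-rotate n g g0≡gn = +-cancelˡ-≡ (χ (g 0)) _ _ (begin
  χ (g 0) + count n (g ∘ suc)   ≡⟨ cong (λ k → count k g) (+-comm 1 n) ⟩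
  count (n + 1) g               ≡⟨ sumBelow-split n 1 (χ ∘ g) ⟩
  count n g + (χ (g (n + 0)) + 0) ≡⟨ cong (λ v → count n g + (χ (g v) + 0)) (+-identityʳ n) ⟩
  count n g + (χ (g n) + 0)     ≡⟨ cong (λ b → count n g + (χ b + 0)) (sym g0≡gn) ⟩
  count n g + (χ (g 0) + 0)     ≡⟨ cong (count n g +_) (+-identityʳ _) ⟩
  count n g + χ (g 0)           ≡⟨ +-comm (count n g) _ ⟩
  χ (g 0) + count n g           ∎)
  where open ≡-Reasoning

length-filter-applyUpTo : ∀ {A : Set} {P : A → Set} (P? : Decidable P) (f : ℕ → A) m →
                          length (filter P? (applyUpTo f m)) ≡ count m (λ v → does (P? (f v)))
length-filter-applyUpTo P? f zero = refl
length-filter-applyUpTo P? f (suc m) with does (P? (f 0))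
... | true  = cong suc (length-filter-applyUpTo P? (f ∘ suc) m)
... | false = length-filter-applyUpTo P? (f ∘ suc) m

_∣ᵇ_ : ℕ → ℕ → Bool
d ∣ᵇ v = does (d ∣? v)

∣⇒∣ᵇ≡true : ∀ {d v} → d ∣ v → d ∣ᵇ v ≡ true
∣⇒∣ᵇ≡true {d} {v} = dec-true (d ∣? v)

∤⇒∣ᵇ≡false : ∀ {d v} → ¬ d ∣ v → d ∣ᵇ v ≡ false
∤⇒∣ᵇ≡false {d} {v} = dec-false (d ∣? v)

∣ᵇ≡false⇒∤ : ∀ {d v} → d ∣ᵇ v ≡ false → ¬ d ∣ v
∣ᵇ≡false⇒∤ eq d∣v = contradiction (trans (sym eq) (∣⇒∣ᵇ≡true d∣v)) λ ()

∣ᵇ≡true⇒∣ : ∀ {d v} → d ∣ᵇ v ≡ true → d ∣ v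
∣ᵇ≡true⇒∣ {d} {v} eq with d ∣? v
... | yes d∣v = d∣v

∣ᵇ-+ : ∀ d v → d ∣ᵇ (d + v) ≡ d ∣ᵇ v
∣ᵇ-+ d v =
  does-⇔ (mk⇔ (λ d∣d+v → ∣m+n∣m⇒∣n d∣d+v ∣-refl) (∣m∣n⇒∣m+n ∣-refl)) (d ∣? d + v) (d ∣? v)

count-multiples-below : ∀ d .{{_ : NonZero d}} (g : ℕ → Bool) → count d (λ v → d ∣ᵇ v ∧ g v) ≡ χ (g 0)
count-multiples-below (suc e) g = begin
  χ (g 0) + count e (λ v → suc e ∣ᵇ suc v ∧ g (suc v)) ≡⟨ cong (χ (g 0) +_) (count-cong e nonMultiple) ⟩
  χ (g 0) + count e (λ _ → false)                     ≡⟨ cong (χ (g 0) +_) (sumBelow-zero e) ⟩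
  χ (g 0) + 0                                         ≡⟨ +-identityʳ _ ⟩
  χ (g 0)                                             ∎
  where
  open ≡-Reasoning
  nonMultiple : ∀ {v} → v < e → suc e ∣ᵇ suc v ∧ g (suc v) ≡ false
  nonMultiple {v} v<e = cong (_∧ g (suc v)) (∤⇒∣ᵇ≡false (λ e+1∣v+1 → <⇒≱ (s≤s v<e) (∣⇒≤ e+1∣v+1)))

count-multiples : ∀ d .{{_ : NonZero d}} m (g : ℕ → Bool) →
                  count (d * m) (λ v → d ∣ᵇ v ∧ g v) ≡ count m (λ t → g (d * t))
count-multiples d zero    g = cong (λ k → count k (λ v → d ∣ᵇ v ∧ g v)) (*-zeroʳ d)
count-multiples d (suc m) g = begin
  count (d * suc m) multiple
    ≡⟨ cong (λ k → count k multiple) (*-suc d m) ⟩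
  count (d + d * m) multiple
    ≡⟨ sumBelow-split d (d * m) (χ ∘ multiple) ⟩
  count d multiple + count (d * m) (multiple ∘ (d +_))
    ≡⟨ cong₂ _+_ (count-multiples-below d g) (count-cong (d * m) shift) ⟩
  χ (g 0) + count (d * m) (λ u → d ∣ᵇ u ∧ g (d + u))
    ≡⟨ cong₂ _+_ (cong (χ ∘ g) (sym (*-zeroʳ d))) (count-multiples d m (g ∘ (d +_))) ⟩
  χ (g (d * 0)) + count m (λ t → g (d + d * t))
    ≡⟨ cong (χ (g (d * 0)) +_) (count-cong m (λ {t} _ → cong g (sym (*-suc d t)))) ⟩
  count (suc m) (λ t → g (d * t))
    ∎
  where
  open ≡-Reasoning
  multiple : ℕ → Bool
  multiple v = d ∣ᵇ v ∧ g v
  shift : ∀ {u} → u < d * m → multiple (d + u) ≡ d ∣ᵇ u ∧ g (d + u)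
  shift {u} _ = cong (_∧ g (d + u)) (∣ᵇ-+ d u)

count-multiples-only : ∀ d .{{_ : NonZero d}} m → count (d * m) (d ∣ᵇ_) ≡ m
count-multiples-only d m = begin
  count (d * m) (d ∣ᵇ_)                   ≡⟨ count-cong (d * m) (λ {v} _ → sym (∧-identityʳ (d ∣ᵇ v))) ⟩
  count (d * m) (λ v → d ∣ᵇ v ∧ true)     ≡⟨ count-multiples d m (λ _ → true) ⟩
  count m (λ _ → true)                    ≡⟨ count-true m ⟩
  m                                       ∎
  where open ≡-Reasoning

-- Primes

multiple-below⇒0 : ∀ {m v} → v < m → m ∣ v → v ≡ 0
multiple-below⇒0 {v = zero}  _   _   = refl
multiple-below⇒0 {v = suc v} v<m m∣v = contradiction (∣⇒≤ m∣v) (<⇒≱ v<m)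

1<prime : ∀ {x} → Prime x → 1 < x
1<prime {x} px = nonTrivial⇒n>1 x {{prime⇒nonTrivial px}}

prime≢1 : ∀ {x} → Prime x → x ≢ 1
prime≢1 px x≡1 = <-irrefl (sym x≡1) (1<prime px)

distinct-primes-∤ : ∀ {x y} → Prime x → Prime y → x ≢ y → ¬ x ∣ y
distinct-primes-∤ px py x≢y x∣y with prime⇒irreducible py x∣y
... | inj₁ x≡1 = prime≢1 px x≡1
... | inj₂ x≡y = x≢y x≡y

prime∤⇒coprime : ∀ {x m} → Prime x → ¬ x ∣ m → Coprime x m
prime∤⇒coprime px x∤m (i∣x , i∣m) with prime⇒irreducible px i∣x
... | inj₁ i≡1 = i≡1
... | inj₂ refl = ⊥-elim (x∤m i∣m)

prime∤* : ∀ {x a b} → Prime x → ¬ x ∣ a → ¬ x ∣ b → ¬ x ∣ a * b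
prime∤* {a = a} {b} px x∤a x∤b x∣ab with euclidsLemma a b px x∣ab
... | inj₁ x∣a = x∤a x∣a
... | inj₂ x∣b = x∤b x∣b

prime∣ᵇ-* : ∀ {x d} → Prime x → ¬ x ∣ d → ∀ t → x ∣ᵇ (d * t) ≡ x ∣ᵇ t
prime∣ᵇ-* {x} {d} px x∤d t =
  does-⇔ (mk⇔ (coprime-divisor (prime∤⇒coprime px x∤d)) (∣n⇒∣m*n d)) (x ∣? d * t) (x ∣? t)

prime∣*⇔ : ∀ {x} a b → Prime x → x ∣ a * b ⇔ (x ∣ᵇ a ∨ x ∣ᵇ b) ≡ true
prime∣*⇔ {x} a b px = mk⇔ to from
  where
  to : x ∣ a * b → (x ∣ᵇ a ∨ x ∣ᵇ b) ≡ true
  to x∣ab with euclidsLemma a b px x∣ab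
  ... | inj₁ x∣a = Equivalence.from ∨≡true⇔ (inj₁ (∣⇒∣ᵇ≡true x∣a))
  ... | inj₂ x∣b = Equivalence.from (∨≡true⇔ {x ∣ᵇ a}) (inj₂ (∣⇒∣ᵇ≡true x∣b))
  from : (x ∣ᵇ a ∨ x ∣ᵇ b) ≡ true → x ∣ a * b
  from bits with Equivalence.to (∨≡true⇔ {x ∣ᵇ a}) bits
  ... | inj₁ x∣ᵇa = ∣m⇒∣m*n b (∣ᵇ≡true⇒∣ x∣ᵇa)
  ... | inj₂ x∣ᵇb = ∣n⇒∣m*n a (∣ᵇ≡true⇒∣ x∣ᵇb)

coprime⇒*∣ : ∀ {x y v} → Coprime x y → x ∣ v → y ∣ v → x * y ∣ v
coprime⇒*∣ {x} {y} {v} x⊥y x∣v y∣v = subst (_∣ v) lcm≡xy (lcm-least x∣v y∣v)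
  where
  lcm≡xy : lcm x y ≡ x * y
  lcm≡xy = trans (sym (*-identityˡ (lcm x y))) (trans (cong (_* lcm x y) (sym (coprime⇒gcd≡1 x⊥y))) (gcd*lcm x y))

even-or-odd : ∀ m → 2 ∣ m ⊎ 2 ∣ suc m
even-or-odd zero    = inj₁ (2 ∣0)
even-or-odd (suc m) with even-or-odd m
... | inj₁ 2∣m   = inj₂ (∣m∣n⇒∣m+n ∣-refl 2∣m)
... | inj₂ 2∣1+m = inj₁ 2∣1+m

even-prime : ∀ {x} → Prime x → 2 ∣ x → x ≡ 2
even-prime px 2∣x with prime⇒irreducible px 2∣x
... | inj₂ 2≡x = sym 2≡x

consecutive-primes : ∀ {x} → Prime x → Prime (suc x) → x ≡ 2
consecutive-primes {x} px px+1 with even-or-odd x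
... | inj₁ 2∣x   = even-prime px 2∣x
... | inj₂ 2∣x+1 = contradiction (cong pred (even-prime px+1 2∣x+1)) (prime≢1 px)

odd-primes-gap : ∀ {y z} → Prime y → Prime z → 2 < y → y < z → 2 + y ≤ z
odd-primes-gap py pz 2<y y<z =
  ≤∧≢⇒< y<z (λ 1+y≡z → <⇒≢ 2<y (sym (consecutive-primes py (subst Prime (sym 1+y≡z) pz))))

-- Euler's totient

gcd≡1⇔prime∤ : ∀ {x} t → Prime x → gcd t x ≡ 1 ⇔ (¬ x ∣ t)
gcd≡1⇔prime∤ {x} t px = mk⇔ to from
  where
  to : gcd t x ≡ 1 → ¬ x ∣ t
  to g≡1 x∣t = prime≢1 px (∣1⇒≡1 (subst (x ∣_) g≡1 (gcd-greatest x∣t ∣-refl)))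
  from : ¬ x ∣ t → gcd t x ≡ 1
  from x∤t with prime⇒irreducible px (gcd[m,n]∣n t x)
  ... | inj₁ g≡1 = g≡1
  ... | inj₂ g≡x = ⊥-elim (x∤t (subst (_∣ t) g≡x (gcd[m,n]∣m t x)))

gcd≡1⇔primes∤ : ∀ {x y} t → Prime x → Prime y → gcd t (x * y) ≡ 1 ⇔ ((¬ x ∣ t) × (¬ y ∣ t))
gcd≡1⇔primes∤ {x} {y} t px py = mk⇔ to from
  where
  g : ℕ
  g = gcd t (x * y)
  g∣t : g ∣ t
  g∣t = gcd[m,n]∣m t (x * y)
  to : g ≡ 1 → (¬ x ∣ t) × (¬ y ∣ t)
  to g≡1 = (λ x∣t → prime≢1 px (∣1⇒≡1 (subst (x ∣_) g≡1 (gcd-greatest x∣t (m∣m*n y)))))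
         , (λ y∣t → prime≢1 py (∣1⇒≡1 (subst (y ∣_) g≡1 (gcd-greatest y∣t (n∣m*n x)))))
  g∣y : ¬ x ∣ t → g ∣ y
  g∣y x∤t = coprime-divisor (Coprimality.sym (prime∤⇒coprime px (λ x∣g → x∤t (∣-trans x∣g g∣t))))
                            (gcd[m,n]∣n t (x * y))
  from : (¬ x ∣ t) × (¬ y ∣ t) → g ≡ 1
  from (x∤t , y∤t) with prime⇒irreducible py (g∣y x∤t)
  ... | inj₁ g≡1 = g≡1
  ... | inj₂ g≡y = ⊥-elim (y∤t (subst (_∣ t) g≡y g∣t))

-- φ m counts 1, …, m while count m counts 0, …, m - 1; the hypothesis g 0 ≡ g m bridges the shift.
φ-as-count : ∀ m (g : ℕ → Bool) → (∀ t → does (gcd t m ≟ 1) ≡ g t) → g 0 ≡ g m → φ m ≡ count m g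
φ-as-count m g coprime≡g g0≡gm = begin
  φ m
    ≡⟨ cong (length ∘ filter (λ k → gcd k m ≟ 1)) (map-upTo suc m) ⟩
  length (filter (λ k → gcd k m ≟ 1) (applyUpTo suc m))
    ≡⟨ length-filter-applyUpTo (λ k → gcd k m ≟ 1) suc m ⟩
  count m (λ t → does (gcd (suc t) m ≟ 1))
    ≡⟨ count-cong m (λ {t} _ → coprime≡g (suc t)) ⟩
  count m (g ∘ suc)
    ≡⟨ count-rotate m g g0≡gm ⟩
  count m g
    ∎
  where open ≡-Reasoning

φ-prime-count : ∀ {x} → Prime x → φ x ≡ count x (λ t → not (x ∣ᵇ t))
φ-prime-count {x} px = φ-as-count x (λ t → not (x ∣ᵇ t))
  (λ t → does-⇔ (gcd≡1⇔prime∤ t px) (gcd t x ≟ 1) (¬? (x ∣? t)))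
  (cong not (trans (∣⇒∣ᵇ≡true (x ∣0)) (sym (∣⇒∣ᵇ≡true (∣-refl {x})))))

φ-primes-count : ∀ {x y} → Prime x → Prime y →
                 φ (x * y) ≡ count (x * y) (λ t → not (x ∣ᵇ t) ∧ not (y ∣ᵇ t))
φ-primes-count {x} {y} px py = φ-as-count (x * y) (λ t → not (x ∣ᵇ t) ∧ not (y ∣ᵇ t))
  (λ t → does-⇔ (gcd≡1⇔primes∤ t px py) (gcd t (x * y) ≟ 1) (¬? (x ∣? t) ×-dec ¬? (y ∣? t)))
  (cong₂ (λ a b → not a ∧ not b) (trans (∣⇒∣ᵇ≡true (x ∣0)) (sym (∣⇒∣ᵇ≡true (m∣m*n {x} y))))
                                 (trans (∣⇒∣ᵇ≡true (y ∣0)) (sym (∣⇒∣ᵇ≡true (n∣m*n x {y})))))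

φ-prime : ∀ {x} → Prime x → suc (φ x) ≡ x
φ-prime {x} px = begin
  suc (φ x)                                        ≡⟨ cong suc (φ-prime-count px) ⟩
  1 + count x (λ t → not (x ∣ᵇ t))                 ≡⟨ cong (_+ count x (λ t → not (x ∣ᵇ t))) multiples ⟨
  count x (x ∣ᵇ_) + count x (λ t → not (x ∣ᵇ t))   ≡⟨ count-complement x (x ∣ᵇ_) ⟩
  x                                                ∎
  where
  open ≡-Reasoning
  multiples : count x (x ∣ᵇ_) ≡ 1
  multiples = trans (cong (λ k → count k (x ∣ᵇ_)) (sym (*-identityʳ x)))
                    (count-multiples-only x {{prime⇒nonZero px}} 1)

φ-multiplicative : ∀ {x y} → Prime x → Prime y → x ≢ y → φ (x * y) ≡ φ x * φ y
φ-multiplicative {x} {y} px py x≢y = cancel {φ x} {φ y} {φ (x * y)} (begin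
  suc (φ y) + (φ x + φ (x * y))  ≡⟨ cong (_+ (φ x + φ (x * y))) (φ-prime py) ⟩
  y + (φ x + φ (x * y))          ≡⟨ inclusion-exclusion ⟩
  x * y                          ≡⟨ cong₂ _*_ (φ-prime px) (φ-prime py) ⟨
  suc (φ x) * suc (φ y)          ∎)
  where
  open ≡-Reasoning
  cancel : ∀ {a b w} → suc b + (a + w) ≡ suc a * suc b → w ≡ a * b
  cancel {a} {b} {w} eq = +-cancelˡ-≡ a w (a * b) (trans (+-cancelˡ-≡ (suc b) (a + w) (a * suc b) eq) (*-suc a b))
  x∤ : ℕ → Bool
  x∤ t = not (x ∣ᵇ t)
  multiples-of-y : count (x * y) (λ t → x∤ t ∧ y ∣ᵇ t) ≡ φ x
  multiples-of-y = begin
    count (x * y) (λ t → x∤ t ∧ y ∣ᵇ t) ≡⟨ cong (λ k → count k (λ t → x∤ t ∧ y ∣ᵇ t)) (*-comm x y) ⟩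
    count (y * x) (λ t → x∤ t ∧ y ∣ᵇ t) ≡⟨ count-cong (y * x) (λ {t} _ → ∧-comm (x∤ t) (y ∣ᵇ t)) ⟩
    count (y * x) (λ t → y ∣ᵇ t ∧ x∤ t) ≡⟨ count-multiples y {{prime⇒nonZero py}} x x∤ ⟩
    count x (λ s → x∤ (y * s))          ≡⟨ count-cong x (λ {s} _ → cong not (prime∣ᵇ-* px x∤y s)) ⟩
    count x x∤                          ≡⟨ φ-prime-count px ⟨
    φ x                                 ∎
    where
    x∤y : ¬ x ∣ y
    x∤y = distinct-primes-∤ px py x≢y
  inclusion-exclusion : y + (φ x + φ (x * y)) ≡ x * y
  inclusion-exclusion = begin
    y + (φ x + φ (x * y))
      ≡⟨ cong₂ (λ a b → a + (b + φ (x * y))) (count-multiples-only x {{prime⇒nonZero px}} y) multiples-of-y ⟨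
    count (x * y) (x ∣ᵇ_) + (count (x * y) (λ t → x∤ t ∧ y ∣ᵇ t) + φ (x * y))
      ≡⟨ cong (λ c → count (x * y) (x ∣ᵇ_) + (count (x * y) (λ t → x∤ t ∧ y ∣ᵇ t) + c))
              (φ-primes-count px py) ⟩
    count (x * y) (x ∣ᵇ_) + (count (x * y) (λ t → x∤ t ∧ y ∣ᵇ t)
                             + count (x * y) (λ t → x∤ t ∧ not (y ∣ᵇ t)))
      ≡⟨ cong (count (x * y) (x ∣ᵇ_) +_) (count-split (x * y) x∤ (y ∣ᵇ_)) ⟨
    count (x * y) (x ∣ᵇ_) + count (x * y) x∤
      ≡⟨ count-complement (x * y) (x ∣ᵇ_) ⟩
    x * y
      ∎

1≤φ-prime : ∀ {x} → Prime x → 1 ≤ φ x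
1≤φ-prime px = s≤s⁻¹ (subst (1 <_) (sym (φ-prime px)) (1<prime px))

φ-prime-+-mono-≤ : ∀ {x y} k → Prime x → Prime y → k + x ≤ y → k + φ x ≤ φ y
φ-prime-+-mono-≤ {x} {y} k px py k+x≤y =
  s≤s⁻¹ (subst₂ _≤_ (trans (cong (k +_) (sym (φ-prime px))) (+-suc k (φ x))) (sym (φ-prime py)) k+x≤y)

count-exactly-one : ∀ {x y z} .{{_ : NonZero x}} → Prime y → Prime z → ¬ y ∣ x → ¬ z ∣ x →
                    count (x * (y * z)) (λ v → x ∣ᵇ v ∧ (not (y ∣ᵇ v) ∧ not (z ∣ᵇ v))) ≡ φ (y * z)
count-exactly-one {x} {y} {z} py pz y∤x z∤x = begin
  count (x * (y * z)) (λ v → x ∣ᵇ v ∧ (not (y ∣ᵇ v) ∧ not (z ∣ᵇ v)))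
    ≡⟨ count-multiples x (y * z) (λ v → not (y ∣ᵇ v) ∧ not (z ∣ᵇ v)) ⟩
  count (y * z) (λ t → not (y ∣ᵇ (x * t)) ∧ not (z ∣ᵇ (x * t)))
    ≡⟨ count-cong (y * z) (λ {t} _ → cong₂ (λ a b → not a ∧ not b) (prime∣ᵇ-* py y∤x t)
                                                                   (prime∣ᵇ-* pz z∤x t)) ⟩
  count (y * z) (λ t → not (y ∣ᵇ t) ∧ not (z ∣ᵇ t))
    ≡⟨ φ-primes-count py pz ⟨
  φ (y * z) ∎
  where open ≡-Reasoning

count-exactly-two : ∀ {x y z} .{{_ : NonZero x}} → Prime y → Prime z → ¬ y ∣ x → ¬ z ∣ x → ¬ z ∣ y →
                    count (x * (y * z)) (λ v → x ∣ᵇ v ∧ (y ∣ᵇ v ∧ not (z ∣ᵇ v))) ≡ φ z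
count-exactly-two {x} {y} {z} py pz y∤x z∤x z∤y = begin
  count (x * (y * z)) (λ v → x ∣ᵇ v ∧ (y ∣ᵇ v ∧ not (z ∣ᵇ v)))
    ≡⟨ count-multiples x (y * z) (λ v → y ∣ᵇ v ∧ not (z ∣ᵇ v)) ⟩
  count (y * z) (λ t → y ∣ᵇ (x * t) ∧ not (z ∣ᵇ (x * t)))
    ≡⟨ count-cong (y * z) (λ {t} _ → cong₂ (λ a b → a ∧ not b) (prime∣ᵇ-* py y∤x t)
                                                               (prime∣ᵇ-* pz z∤x t)) ⟩
  count (y * z) (λ t → y ∣ᵇ t ∧ not (z ∣ᵇ t))
    ≡⟨ count-multiples y {{prime⇒nonZero py}} z (λ t → not (z ∣ᵇ t)) ⟩
  count z (λ s → not (z ∣ᵇ (y * s)))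
    ≡⟨ count-cong z (λ {s} _ → cong not (prime∣ᵇ-* pz z∤y s)) ⟩
  count z (λ s → not (z ∣ᵇ s))
    ≡⟨ φ-prime-count pz ⟨
  φ z ∎
  where open ≡-Reasoning

-- The graph of divisor classes

module _ {C : Set} (_~_ : C → C → Bool) where

  Independent : (C → Bool) → Set
  Independent X = ∀ τ σ → X τ ≡ true → X σ ≡ true → τ ~ σ ≡ false

  Dominating : (C → Bool) → Set
  Dominating X = ∀ τ → X τ ≡ false → ∃ λ σ → X σ ≡ true × τ ~ σ ≡ true

  IndependentDominating : (C → Bool) → Set
  IndependentDominating X = Independent X × Dominating X

  leaf-membership : ∀ {X τ π} → IndependentDominating X →
                    (∀ σ → τ ~ σ ≡ true → σ ≡ π) → τ ~ π ≡ true → X τ ≡ not (X π)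
  leaf-membership {X} {τ} {π} (ind , dom) onlyNeighbour τ~π with X π in Xπ | X τ in Xτ
  ... | true  | true  = contradiction (trans (sym τ~π) (ind τ π Xτ Xπ)) (λ ())
  ... | true  | false = refl
  ... | false | true  = refl
  ... | false | false with dom τ Xτ
  ...   | σ , Xσ , τ~σ with refl ← onlyNeighbour σ τ~σ = contradiction (trans (sym Xπ) Xσ) (λ ())

-- V_I consists of the residues whose prime divisors among p₁ = p, p₂ = q, p₃ = r are exactly the p_i
-- with i ∈ I; has_i τ records whether p_i divides the members of τ.
data Class : Set where
  V₁ V₂ V₃ V₁₂ V₁₃ V₂₃ : Class

has₁ has₂ has₃ : Class → Bool
has₁ V₁  = true
has₁ V₂  = false
has₁ V₃  = false
has₁ V₁₂ = true
has₁ V₁₃ = true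
has₁ V₂₃ = false
has₂ V₁  = false
has₂ V₂  = true
has₂ V₃  = false
has₂ V₁₂ = true
has₂ V₁₃ = false
has₂ V₂₃ = true
has₃ V₁  = false
has₃ V₂  = false
has₃ V₃  = true
has₃ V₁₂ = false
has₃ V₁₃ = true
has₃ V₂₃ = true

classOf : Bool → Bool → Bool → Maybe Class
classOf true  false false = just V₁
classOf false true  false = just V₂
classOf false false true  = just V₃
classOf true  true  false = just V₁₂
classOf true  false true  = just V₁₃
classOf false true  true  = just V₂₃
classOf true  true  true  = nothing
classOf false false false = nothing

classOf-has : ∀ b₁ b₂ b₃ {τ} → classOf b₁ b₂ b₃ ≡ just τ →
              b₁ ≡ has₁ τ × b₂ ≡ has₂ τ × b₃ ≡ has₃ τ
classOf-has true  false false refl = refl , refl , refl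
classOf-has false true  false refl = refl , refl , refl
classOf-has false false true  refl = refl , refl , refl
classOf-has true  true  false refl = refl , refl , refl
classOf-has true  false true  refl = refl , refl , refl
classOf-has false true  true  refl = refl , refl , refl

classOf-nothing : ∀ b₁ b₂ b₃ → classOf b₁ b₂ b₃ ≡ nothing →
                  (b₁ ≡ true × b₂ ≡ true × b₃ ≡ true) ⊎ (b₁ ≡ false × b₂ ≡ false × b₃ ≡ false)
classOf-nothing true  true  true  _ = inj₁ (refl , refl , refl)
classOf-nothing false false false _ = inj₂ (refl , refl , refl)
classOf-nothing true  false false ()
classOf-nothing false true  false ()
classOf-nothing false false true  ()
classOf-nothing true  true  false ()
classOf-nothing true  false true  ()
classOf-nothing false true  true  ()

annihilate : Class → Class → Bool
annihilate τ σ = (has₁ τ ∨ has₁ σ) ∧ (has₂ τ ∨ has₂ σ) ∧ (has₃ τ ∨ has₃ σ)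

annihilate-irrefl : ∀ τ → annihilate τ τ ≡ false
annihilate-irrefl V₁  = refl
annihilate-irrefl V₂  = refl
annihilate-irrefl V₃  = refl
annihilate-irrefl V₁₂ = refl
annihilate-irrefl V₁₃ = refl
annihilate-irrefl V₂₃ = refl

complement : Class → Class
complement V₁  = V₂₃
complement V₂  = V₁₃
complement V₃  = V₁₂
complement V₁₂ = V₃
complement V₁₃ = V₂
complement V₂₃ = V₁

annihilate-complement : ∀ τ → annihilate τ (complement τ) ≡ true
annihilate-complement V₁  = refl
annihilate-complement V₂  = refl
annihilate-complement V₃  = refl
annihilate-complement V₁₂ = refl
annihilate-complement V₁₃ = refl
annihilate-complement V₂₃ = refl

only-neighbour-V₁ : ∀ σ → annihilate V₁ σ ≡ true → σ ≡ V₂₃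
only-neighbour-V₁ V₂₃ _ = refl
only-neighbour-V₁ V₁  ()
only-neighbour-V₁ V₂  ()
only-neighbour-V₁ V₃  ()
only-neighbour-V₁ V₁₂ ()
only-neighbour-V₁ V₁₃ ()

only-neighbour-V₂ : ∀ σ → annihilate V₂ σ ≡ true → σ ≡ V₁₃
only-neighbour-V₂ V₁₃ _ = refl
only-neighbour-V₂ V₁  ()
only-neighbour-V₂ V₂  ()
only-neighbour-V₂ V₃  ()
only-neighbour-V₂ V₁₂ ()
only-neighbour-V₂ V₂₃ ()

only-neighbour-V₃ : ∀ σ → annihilate V₃ σ ≡ true → σ ≡ V₁₂
only-neighbour-V₃ V₁₂ _ = refl
only-neighbour-V₃ V₁  ()
only-neighbour-V₃ V₂  ()
only-neighbour-V₃ V₃  ()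
only-neighbour-V₃ V₁₃ ()
only-neighbour-V₃ V₂₃ ()

-- Each prime class V_i has V_jk as its only neighbour, so by leaf-membership an independent dominating
-- class set is determined by the pair classes it contains.
byPairs : Bool → Bool → Bool → Class → Bool
byPairs b₁₂ b₁₃ b₂₃ V₁  = not b₂₃
byPairs b₁₂ b₁₃ b₂₃ V₂  = not b₁₃
byPairs b₁₂ b₁₃ b₂₃ V₃  = not b₁₂
byPairs b₁₂ b₁₃ b₂₃ V₁₂ = b₁₂
byPairs b₁₂ b₁₃ b₂₃ V₁₃ = b₁₃
byPairs b₁₂ b₁₃ b₂₃ V₂₃ = b₂₃

I₀ I₁₂ I₁₃ I₂₃ : Class → Bool
I₀  = byPairs false false false
I₁₂ = byPairs true  false false
I₁₃ = byPairs false true  false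
I₂₃ = byPairs false false true

independentDominatingClassSets : List (Class → Bool)
independentDominatingClassSets = I₀ ∷ I₁₂ ∷ I₁₃ ∷ I₂₃ ∷ []

independentDominating-byPairs : ∀ {X} → IndependentDominating annihilate X →
                                X ≗ byPairs (X V₁₂) (X V₁₃) (X V₂₃)
independentDominating-byPairs X-indDom V₁  = leaf-membership annihilate X-indDom only-neighbour-V₁ refl
independentDominating-byPairs X-indDom V₂  = leaf-membership annihilate X-indDom only-neighbour-V₂ refl
independentDominating-byPairs X-indDom V₃  = leaf-membership annihilate X-indDom only-neighbour-V₃ refl
independentDominating-byPairs X-indDom V₁₂ = refl
independentDominating-byPairs X-indDom V₁₃ = refl
independentDominating-byPairs X-indDom V₂₃ = refl

classify : ∀ {X} → IndependentDominating annihilate X → Any (X ≗_) independentDominatingClassSets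
classify {X} X-indDom@(ind , _) = byPairs-cases (X V₁₂) (X V₁₃) (X V₂₃) (independentDominating-byPairs X-indDom)
  where
  byPairs-cases : ∀ b₁₂ b₁₃ b₂₃ → X ≗ byPairs b₁₂ b₁₃ b₂₃ → Any (X ≗_) independentDominatingClassSets
  byPairs-cases false false false X≗ = here X≗
  byPairs-cases true  false false X≗ = there (here X≗)
  byPairs-cases false true  false X≗ = there (there (here X≗))
  byPairs-cases false false true  X≗ = there (there (there (here X≗)))
  byPairs-cases true  true  _     X≗ = contradiction (ind V₁₂ V₁₃ (X≗ V₁₂) (X≗ V₁₃)) λ ()
  byPairs-cases true  _     true  X≗ = contradiction (ind V₁₂ V₂₃ (X≗ V₁₂) (X≗ V₂₃)) λ ()
  byPairs-cases _     true  true  X≗ = contradiction (ind V₁₃ V₂₃ (X≗ V₁₃) (X≗ V₂₃)) λ ()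

allClasses : List Class
allClasses = V₁ ∷ V₂ ∷ V₃ ∷ V₁₂ ∷ V₁₃ ∷ V₂₃ ∷ []

∈-allClasses : ∀ τ → τ ∈ allClasses
∈-allClasses V₁  = here refl
∈-allClasses V₂  = there (here refl)
∈-allClasses V₃  = there (there (here refl))
∈-allClasses V₁₂ = there (there (there (here refl)))
∈-allClasses V₁₃ = there (there (there (there (here refl))))
∈-allClasses V₂₃ = there (there (there (there (there (here refl)))))

independentᵇ dominatingᵇ : (Class → Bool) → Bool
independentᵇ X = all (λ τ → all (λ σ → not (X τ ∧ X σ ∧ annihilate τ σ)) allClasses) allClasses
dominatingᵇ  X = all (λ τ → X τ ∨ any (λ σ → X σ ∧ annihilate τ σ) allClasses) allClasses

independentᵇ-sound : ∀ X → T (independentᵇ X) → Independent annihilate X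
independentᵇ-sound X h τ σ Xτ Xσ =
  Equivalence.to T-not-≡ (subst₂ (λ b b′ → T (not (b ∧ b′ ∧ annihilate τ σ))) Xτ Xσ pair)
  where
  nonAdjacentᵇ : Class → Class → Bool
  nonAdjacentᵇ τ σ = not (X τ ∧ X σ ∧ annihilate τ σ)
  row : T (all (nonAdjacentᵇ τ) allClasses)
  row = All.lookup (all⁺ (λ τ → all (nonAdjacentᵇ τ) allClasses) allClasses h) (∈-allClasses τ)
  pair : T (nonAdjacentᵇ τ σ)
  pair = All.lookup (all⁺ (nonAdjacentᵇ τ) allClasses row) (∈-allClasses σ)

dominatingᵇ-sound : ∀ X → T (dominatingᵇ X) → Dominating annihilate X
dominatingᵇ-sound X h τ Xτ =
  let σ , Xσ∧τ~σ = satisfied (any⁻ (neighbourᵇ τ) allClasses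
                               (subst (λ b → T (b ∨ any (neighbourᵇ τ) allClasses)) Xτ entry))
      Xσ , τ~σ   = Equivalence.to (T-∧ {X σ}) Xσ∧τ~σ
  in σ , Equivalence.to T-≡ Xσ , Equivalence.to T-≡ τ~σ
  where
  neighbourᵇ : Class → Class → Bool
  neighbourᵇ τ σ = X σ ∧ annihilate τ σ
  entry : T (X τ ∨ any (neighbourᵇ τ) allClasses)
  entry = All.lookup (all⁺ (λ τ → X τ ∨ any (neighbourᵇ τ) allClasses) allClasses h) (∈-allClasses τ)

independentDominatingClassSets-sound : All (IndependentDominating annihilate) independentDominatingClassSets
independentDominatingClassSets-sound = sound I₀ ∷ sound I₁₂ ∷ sound I₁₃ ∷ sound I₂₃ ∷ []
  where
  sound : ∀ X {_ : T (independentᵇ X)} {_ : T (dominatingᵇ X)} → IndependentDominating annihilate X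
  sound X {ind} {dom} = independentᵇ-sound X ind , dominatingᵇ-sound X dom

inPattern : Class → Bool → Bool → Bool → Bool
inPattern V₁  b₁ b₂ b₃ = b₁ ∧ (not b₂ ∧ not b₃)
inPattern V₂  b₁ b₂ b₃ = b₂ ∧ (not b₁ ∧ not b₃)
inPattern V₃  b₁ b₂ b₃ = b₃ ∧ (not b₁ ∧ not b₂)
inPattern V₁₂ b₁ b₂ b₃ = b₁ ∧ (b₂ ∧ not b₃)
inPattern V₁₃ b₁ b₂ b₃ = b₁ ∧ (b₃ ∧ not b₂)
inPattern V₂₃ b₁ b₂ b₃ = b₂ ∧ (b₃ ∧ not b₁)

χ-classOf : ∀ (X : Class → Bool) b₁ b₂ b₃ →
            χ (maybe′ X false (classOf b₁ b₂ b₃))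
              ≡ sum (map (λ τ → χ (inPattern τ b₁ b₂ b₃ ∧ X τ)) allClasses)
χ-classOf X true  false false = sym (+-identityʳ _)
χ-classOf X false true  false = sym (+-identityʳ _)
χ-classOf X false false true  = sym (+-identityʳ _)
χ-classOf X true  true  false = sym (+-identityʳ _)
χ-classOf X true  false true  = sym (+-identityʳ _)
χ-classOf X false true  true  = sym (+-identityʳ _)
χ-classOf X true  true  true  = refl
χ-classOf X false false false = refl

-- Γ(ℤ_n) as the blow-up of a graph _~_ on C, in which every class becomes an independent set.
module BlowUp {n : ℕ} {C : Set} (_~_ : C → C → Bool) (class : Fin n → Maybe C) (rep : C → Fin n)
  (class-rep : ∀ τ → class (rep τ) ≡ just τ)
  (vertex⇔classified : ∀ {a} → ZeroDivisorGraph.IsVertex n a ⇔ ∃ λ τ → class a ≡ just τ)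
  (adjacent⇔ : ∀ {a b τ σ} → class a ≡ just τ → class b ≡ just σ →
               ZeroDivisorGraph.Adj n a b ⇔ τ ~ σ ≡ true)
  where

  open ZeroDivisorGraph n

  lift : (C → Bool) → Subset n
  lift X = tabulate (λ a → maybe′ X false (class a))

  restrict : Subset n → C → Bool
  restrict S τ = lookup S (rep τ)

  vertex : ∀ {a τ} → class a ≡ just τ → IsVertex a
  vertex ca = Equivalence.from vertex⇔classified (_ , ca)

  adjacent : ∀ {a b τ σ} → class a ≡ just τ → class b ≡ just σ → τ ~ σ ≡ true → Adj a b
  adjacent ca cb = Equivalence.from (adjacent⇔ ca cb)

  lookup-lift : ∀ X a → lookup (lift X) a ≡ maybe′ X false (class a)
  lookup-lift X = lookup∘tabulate (λ a → maybe′ X false (class a))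

  restrict-lift : ∀ X → restrict (lift X) ≗ X
  restrict-lift X τ = trans (lookup-lift X (rep τ)) (cong (maybe′ X false) (class-rep τ))

  lift-cong : ∀ {X Y} → X ≗ Y → lift X ≡ lift Y
  lift-cong X≗Y = tabulate-cong (λ a → maybe-cong (class a))
    where
    maybe-cong : ∀ m → maybe′ _ false m ≡ maybe′ _ false m
    maybe-cong nothing  = refl
    maybe-cong (just τ) = X≗Y τ

  ∈-lift⁻ : ∀ {X a} → a ∈ₛ lift X → ∃ λ τ → class a ≡ just τ × X τ ≡ true
  ∈-lift⁻ {X} {a} a∈ with class a | trans (sym (lookup-lift X a)) ([]=⇒lookup a∈)
  ... | just τ | Xτ = τ , refl , Xτ

  ∈-lift⁺ : ∀ {X a τ} → class a ≡ just τ → X τ ≡ true → a ∈ₛ lift X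
  ∈-lift⁺ {X} {a} ca Xτ = lookup⇒[]= a (lift X) (trans (lookup-lift X a) (trans (cong (maybe′ X false) ca) Xτ))

  module _ {S : Subset n} (S-indDom : IsIndependentDominating S) where

    private
      S⊆V : ∀ a → a ∈ₛ S → IsVertex a
      S⊆V = proj₁ S-indDom
      S-indep : ∀ a b → a ∈ₛ S → b ∈ₛ S → ¬ Adj a b
      S-indep = proj₁ (proj₂ S-indDom)
      S-dom : ∀ a → IsVertex a → ¬ a ∈ₛ S → ∃ λ b → b ∈ₛ S × Adj a b
      S-dom = proj₂ (proj₂ S-indDom)

    -- If v ∉ S, the element w ∈ S dominating v has a class annihilating that of v, so it is adjacent to u too.
    same-class-∈ : ∀ {u v τ} → class u ≡ just τ → class v ≡ just τ → u ∈ₛ S → v ∈ₛ S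
    same-class-∈ {u} {v} cu cv u∈S with lookup S v in Sv
    ... | true  = lookup⇒[]= v S Sv
    ... | false with S-dom v (vertex cv) (λ v∈S → contradiction (trans (sym Sv) ([]=⇒lookup v∈S)) λ ())
    ...   | w , w∈S , v-w with Equivalence.to vertex⇔classified (proj₁ (proj₂ v-w))
    ...     | σ , cw = contradiction (adjacent cu cw (Equivalence.to (adjacent⇔ cv cw) v-w)) (S-indep u w u∈S w∈S)

    restrict-indDom : IndependentDominating _~_ (restrict S)
    restrict-indDom = indep , dom
      where
      rep∈S : ∀ {τ} → restrict S τ ≡ true → rep τ ∈ₛ S
      rep∈S = lookup⇒[]= (rep _) S
      indep : Independent _~_ (restrict S)
      indep τ σ Sτ Sσ =
        ¬-not (λ τ~σ → S-indep _ _ (rep∈S Sτ) (rep∈S Sσ) (adjacent (class-rep τ) (class-rep σ) τ~σ))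
      dom : Dominating _~_ (restrict S)
      dom τ Sτ with S-dom (rep τ) (vertex (class-rep τ)) (λ r∈S → contradiction (trans (sym Sτ) ([]=⇒lookup r∈S)) λ ())
      ... | w , w∈S , r-w with Equivalence.to vertex⇔classified (proj₁ (proj₂ r-w))
      ...   | σ , cw = σ , []=⇒lookup (same-class-∈ cw (class-rep σ) w∈S)
                         , Equivalence.to (adjacent⇔ (class-rep τ) cw) r-w

    lift-restrict : S ≡ lift (restrict S)
    lift-restrict = trans (sym (tabulate∘lookup S)) (tabulate-cong pointwise)
      where
      pointwise : ∀ a → lookup S a ≡ maybe′ (restrict S) false (class a)
      pointwise a with class a in ca
      ... | just τ  = bool-≡ (λ Sa → []=⇒lookup (same-class-∈ ca (class-rep τ) (lookup⇒[]= a S Sa)))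
                             (λ Sr → []=⇒lookup (same-class-∈ (class-rep τ) ca (lookup⇒[]= (rep τ) S Sr)))
      ... | nothing = ¬-not (λ Sa → unclassified (Equivalence.to vertex⇔classified (S⊆V a (lookup⇒[]= a S Sa))))
        where
        unclassified : ¬ ∃ λ τ → class a ≡ just τ
        unclassified (τ , ca′) = contradiction (trans (sym ca) ca′) λ ()

  lift-indDom : ∀ {X} → IndependentDominating _~_ X → IsIndependentDominating (lift X)
  lift-indDom {X} (indep , dom) = ⊆V , independent , dominating
    where
    ⊆V : ∀ a → a ∈ₛ lift X → IsVertex a
    ⊆V a a∈ = let τ , ca , _ = ∈-lift⁻ a∈ in vertex ca
    independent : ∀ a b → a ∈ₛ lift X → b ∈ₛ lift X → ¬ Adj a b
    independent a b a∈ b∈ a-b =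
      let τ , ca , Xτ = ∈-lift⁻ a∈
          σ , cb , Xσ = ∈-lift⁻ b∈
      in contradiction (trans (sym (Equivalence.to (adjacent⇔ ca cb) a-b)) (indep τ σ Xτ Xσ)) λ ()
    dominating : ∀ a → IsVertex a → ¬ a ∈ₛ lift X → ∃ λ b → b ∈ₛ lift X × Adj a b
    dominating a va a∉ with Equivalence.to vertex⇔classified va
    ... | τ , ca with X τ in Xτ
    ...   | true  = contradiction (∈-lift⁺ ca Xτ) a∉
    ...   | false = let σ , Xσ , τ~σ = dom τ Xτ
                    in rep σ , ∈-lift⁺ (class-rep σ) Xσ , adjacent ca (class-rep σ) τ~σ

  lift-injective : ∀ {X Y} → lift X ≡ lift Y → X ≗ Y
  lift-injective {X} {Y} eq τ =
    trans (sym (restrict-lift X τ)) (trans (cong (λ S → restrict S τ) eq) (restrict-lift Y τ))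

  independentDominating⇔∈ : ∀ {Xs} → (∀ {X} → IndependentDominating _~_ X → Any (X ≗_) Xs) →
                            All (IndependentDominating _~_) Xs →
                            ∀ S → IsIndependentDominating S ⇔ S ∈ map lift Xs
  independentDominating⇔∈ {Xs} classify Xs-indDom S = mk⇔ to from
    where
    to : IsIndependentDominating S → S ∈ map lift Xs
    to S-indDom = map⁺ (Any.map (trans (lift-restrict S-indDom) ∘ lift-cong) (classify (restrict-indDom S-indDom)))
    from : S ∈ map lift Xs → IsIndependentDominating S
    from S∈ = let X-indDom , S≡X = All.lookupAny Xs-indDom (map⁻ S∈)
              in subst IsIndependentDominating (sym S≡X) (lift-indDom X-indDom)

-- Coefficients from a list of independent dominating sets

∣tabulate∘toℕ∣ : ∀ n (g : ℕ → Bool) → Subset.∣ tabulate {n = n} (g ∘ toℕ) ∣ ≡ count n g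
∣tabulate∘toℕ∣ zero    g = refl
∣tabulate∘toℕ∣ (suc n) g with g 0
... | true  = cong suc (∣tabulate∘toℕ∣ n (g ∘ suc))
... | false = ∣tabulate∘toℕ∣ n (g ∘ suc)

allSubsets-complete : ∀ {m} (S : Subset m) → S ∈ allSubsets m
allSubsets-complete []          = here refl
allSubsets-complete (true  ∷ S) = ∈-++⁺ˡ (∈-map⁺ (inside ∷_) (allSubsets-complete S))
allSubsets-complete (false ∷ S) = ∈-++⁺ʳ _ (∈-map⁺ (outside ∷_) (allSubsets-complete S))

allSubsets-unique : ∀ m → Unique (allSubsets m)
allSubsets-unique zero    = All.[] ∷ []
allSubsets-unique (suc m) = Unique.++⁺ (Unique.map⁺ (Vec.∷-injectiveʳ) (allSubsets-unique m))
                                       (Unique.map⁺ (Vec.∷-injectiveʳ) (allSubsets-unique m))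
                                       heads-differ
  where
  heads-differ : ∀ {S} → ¬ (S ∈ map (inside ∷_) (allSubsets m) × S ∈ map (outside ∷_) (allSubsets m))
  heads-differ (S∈ , S∈′) with ∈-map⁻ (inside ∷_) S∈ | ∈-map⁻ (outside ∷_) S∈′
  ... | _ , _ , refl | _ , _ , ()

length-filter-allSubsets : ∀ {m} {P : Subset m → Set} (P? : Decidable P) {Ss : List (Subset m)} →
                           Unique Ss → (∀ S → P S ⇔ S ∈ Ss) → length (filter P? (allSubsets m)) ≡ length Ss
length-filter-allSubsets {m} P? Ss-unique P⇔∈ =
  ↭-length (∼bag⇒↭ (unique∧set⇒bag (Unique.filter⁺ P? (allSubsets-unique m)) Ss-unique same-elements))
  where
  same-elements : ∀ {S} → S ∈ filter P? (allSubsets m) ⇔ S ∈ _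
  same-elements {S} = mk⇔ (Equivalence.to (P⇔∈ S) ∘ proj₂ ∘ ∈-filter⁻ P? {xs = allSubsets m})
                          (∈-filter⁺ P? (allSubsets-complete S) ∘ Equivalence.from (P⇔∈ S))

coeffOfPowers : List ℕ → ℕ → ℕ
coeffOfPowers es k = length (filter (_≟ k) es)

length-filter-size : ∀ {m} k (Ss : List (Subset m)) →
                     length (filter (λ S → Subset.∣ S ∣ ≟ k) Ss) ≡ coeffOfPowers (map Subset.∣_∣ Ss) k
length-filter-size k []       = refl
length-filter-size k (S ∷ Ss) with does (Subset.∣ S ∣ ≟ k)
... | true  = cong suc (length-filter-size k Ss)
... | false = length-filter-size k Ss

indDomCoeff≡coeffOfPowers : ∀ n {Ss} → Unique Ss →
                            (∀ S → ZeroDivisorGraph.IsIndependentDominating n S ⇔ S ∈ Ss) →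
                            ∀ k → indDomCoeff n k ≡ coeffOfPowers (map Subset.∣_∣ Ss) k
indDomCoeff≡coeffOfPowers n {Ss} Ss-unique indDom⇔∈ k =
  trans (length-filter-allSubsets (λ S → isIndependentDominating? S ×-dec (Subset.∣ S ∣ ≟ k))
                                  (Unique.filter⁺ (λ S → Subset.∣ S ∣ ≟ k) Ss-unique) listed)
        (length-filter-size k Ss)
  where
  open ZeroDivisorGraph n
  listed : ∀ S → (IsIndependentDominating S × Subset.∣ S ∣ ≡ k) ⇔ S ∈ filter (λ S → Subset.∣ S ∣ ≟ k) Ss
  listed S = mk⇔ (λ (S-indDom , size) → ∈-filter⁺ (λ S → Subset.∣ S ∣ ≟ k) (Equivalence.to (indDom⇔∈ S) S-indDom)
                                                   size)
                 (λ S∈ → let S∈Ss , size = ∈-filter⁻ (λ S → Subset.∣ S ∣ ≟ k) S∈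
                         in Equivalence.from (indDom⇔∈ S) S∈Ss , size)

-- Unimodality and log-concavity

degree-bound : ∀ {f b k} → IsDegree f b → f k ≢ 0 → k ≤ b
degree-bound (_ , vanish) fk≢0 = ≮⇒≥ (fk≢0 ∘ vanish _)

nonincreasing-from : ∀ {f : ℕ → ℕ} {b t} → (∀ i → t ≤ i → i < b → f (suc i) ≤ f i) →
                     ∀ {j} d → t ≤ j → j + d ≤ b → f (j + d) ≤ f j
nonincreasing-from {f} decr {j} zero    t≤j _      = ≤-reflexive (cong f (+-identityʳ j))
nonincreasing-from {f} {b} decr {j} (suc d) t≤j j+d<b = begin
  f (j + suc d)  ≡⟨ cong f (+-suc j d) ⟩
  f (suc (j + d)) ≤⟨ decr (j + d) (≤-trans t≤j (m≤m+n j d)) (subst (_≤ b) (+-suc j d) j+d<b) ⟩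
  f (j + d)      ≤⟨ nonincreasing-from decr d t≤j (≤-trans (+-monoʳ-≤ j (n≤1+n d)) j+d<b) ⟩
  f j            ∎
  where open ≤-Reasoning

¬unimodal-if-gap : ∀ {f b i k} → IsDegree f b →
                   f i ≢ 0 → f (suc i) ≡ 0 → suc i < k → f k ≢ 0 → ¬ Unimodal f b
¬unimodal-if-gap {f} {b} {i} {k} deg fi≢0 fi+1≡0 i+1<k fk≢0 (t , _ , incr , decr) with i <? t
... | yes i<t = fi≢0 (n≤0⇒n≡0 (subst (f i ≤_) fi+1≡0 (incr i i<t)))
... | no  i≮t = fk≢0 (n≤0⇒n≡0 (subst (f k ≤_) fi+1≡0 fk≤fi+1))
  where
  d : ℕ
  d = k ∸ suc i
  k≡ : suc i + d ≡ k
  k≡ = m+[n∸m]≡n (<⇒≤ i+1<k)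
  fk≤fi+1 : f k ≤ f (suc i)
  fk≤fi+1 = subst (λ m → f m ≤ f (suc i)) k≡ (nonincreasing-from decr d (≤-trans (≮⇒≥ i≮t) (n≤1+n i))
                                                                 (subst (_≤ b) (sym k≡) (degree-bound deg fk≢0)))

logConcave-if-no-distance-2 : ∀ {f : ℕ → ℕ} b → (∀ i → f i ≢ 0 → f (2 + i) ≡ 0) → LogConcave f b
logConcave-if-no-distance-2 {f} b sparse (suc i) _ _ with f i ≟ 0
... | yes fi≡0 = ≤-trans (≤-reflexive (cong (_* f (2 + i)) fi≡0)) z≤n
... | no  fi≢0 = ≤-trans (≤-reflexive (trans (cong (f i *_) (sparse i fi≢0)) (*-zeroʳ (f i)))) z≤n

¬logConcave-if-gap : ∀ {f b i} → IsDegree f b → f i ≢ 0 → f (suc i) ≡ 0 → f (2 + i) ≢ 0 → ¬ LogConcave f b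
¬logConcave-if-gap {f} {b} {i} deg fi≢0 fi+1≡0 fi+2≢0 lc =
  [ fi≢0 , fi+2≢0 ]′ (m*n≡0⇒m≡0∨n≡0 (f i) product≡0)
  where
  product≡0 : f i * f (2 + i) ≡ 0
  product≡0 = n≤0⇒n≡0 (subst (λ m → f i * f (2 + i) ≤ m * m) fi+1≡0
                              (lc (suc i) (s≤s z≤n) (∸-monoˡ-≤ 1 (degree-bound deg fi+2≢0))))

module _ {f : ℕ → ℕ} {es : List ℕ} (f≗ : f ≗ coeffOfPowers es) where

  ≢0⇒∈ : ∀ {k} → f k ≢ 0 → k ∈ es
  ≢0⇒∈ {k} fk≢0 = ∈-support es (fk≢0 ∘ trans (f≗ k))
    where
    ∈-support : ∀ es → coeffOfPowers es k ≢ 0 → k ∈ es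
    ∈-support []       c≢0 = contradiction refl c≢0
    ∈-support (e ∷ es) c≢0 with e ≟ k
    ... | yes e≡k = here (sym e≡k)
    ... | no  e≢k = there (∈-support es (c≢0 ∘ trans (cong length (filter-reject (_≟ k) e≢k))))

  ∈⇒≢0 : ∀ {k} → k ∈ es → f k ≢ 0
  ∈⇒≢0 {k} k∈es fk≡0 = <⇒≢ (filter-some (_≟ k) (Any.map sym k∈es)) (sym (trans (sym (f≗ k)) fk≡0))

  ∉⇒≡0 : ∀ {k} → k ∉ es → f k ≡ 0
  ∉⇒≡0 {k} k∉es = trans (f≗ k) (cong length (filter-none (_≟ k) (¬Any⇒All¬ es (k∉es ∘ Any.map sym))))

  powers-¬unimodal : ∀ {b i k} → IsDegree f b → i ∈ es → suc i ∉ es → suc i < k → k ∈ es → ¬ Unimodal f b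
  powers-¬unimodal deg i∈ i+1∉ i+1<k k∈ =
    ¬unimodal-if-gap deg (∈⇒≢0 i∈) (∉⇒≡0 i+1∉) i+1<k (∈⇒≢0 k∈)

  powers-¬logConcave : ∀ {b i} → IsDegree f b → i ∈ es → suc i ∉ es → 2 + i ∈ es → ¬ LogConcave f b
  powers-¬logConcave deg i∈ i+1∉ i+2∈ = ¬logConcave-if-gap deg (∈⇒≢0 i∈) (∉⇒≡0 i+1∉) (∈⇒≢0 i+2∈)

  powers-logConcave : ∀ b → (∀ {i} → i ∈ es → 2 + i ∉ es) → LogConcave f b
  powers-logConcave b no-distance-2 = logConcave-if-no-distance-2 b sparse
    where
    sparse : ∀ i → f i ≢ 0 → f (2 + i) ≡ 0
    sparse i fi≢0 with f (2 + i) ≟ 0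
    ... | yes fi+2≡0 = fi+2≡0
    ... | no  fi+2≢0 = contradiction (≢0⇒∈ fi+2≢0) (no-distance-2 (≢0⇒∈ fi≢0))

-- With a = φ p, b = φ q, c = φ r these are the sizes of the lifts of I₀, I₁₂, I₁₃ and I₂₃.
e₀ e₁₂ e₁₃ e₂₃ : ℕ → ℕ → ℕ → ℕ
e₀  a b c = b * c + a * c + a * b
e₁₂ a b c = b * c + a * c + c
e₁₃ a b c = b * c + a * b + b
e₂₃ a b c = a * c + a * b + a

exponents : ℕ → ℕ → ℕ → List ℕ
exponents a b c = e₀ a b c ∷ e₁₂ a b c ∷ e₁₃ a b c ∷ e₂₃ a b c ∷ []

pattern at₀  eq = here eq
pattern at₁₂ eq = there (here eq)
pattern at₁₃ eq = there (there (here eq))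
pattern at₂₃ eq = there (there (there (here eq)))

-- The differences are e₀ - e₁₂ = ab - c, e₁₃ - e₂₃ = (b - a)(c + 1), e₁₂ - e₁₃ = (a + 1)(c - b) and
-- e₀ - e₁₃ = ac - b; below they are stated without subtraction.
e₀+c≡e₁₂+ab : ∀ a b c → e₀ a b c + c ≡ e₁₂ a b c + a * b
e₀+c≡e₁₂+ab = solve 3 (λ a b c → b :* c :+ a :* c :+ a :* b :+ c := b :* c :+ a :* c :+ c :+ a :* b) refl

e₁₃≡[1+B][1+c]+e₂₃ : ∀ a B c → e₁₃ a (suc (a + B)) c ≡ suc B * suc c + e₂₃ a (suc (a + B)) c
e₁₃≡[1+B][1+c]+e₂₃ = solve 3 (λ a B c → let b = con 1 :+ (a :+ B) in
  b :* c :+ a :* b :+ b := (con 1 :+ B) :* (con 1 :+ c) :+ (a :* c :+ a :* b :+ a)) refl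

e₁₂≡[1+a][2+C]+e₁₃ : ∀ a b C → e₁₂ a b (2 + b + C) ≡ suc a * (2 + C) + e₁₃ a b (2 + b + C)
e₁₂≡[1+a][2+C]+e₁₃ = solve 3 (λ a b C → let c = con 2 :+ b :+ C in
  b :* c :+ a :* c :+ c := (con 1 :+ a) :* (con 2 :+ C) :+ (b :* c :+ a :* b :+ b)) refl

e₀≡2+slack+e₁₃ : ∀ A b C → e₀ (suc A) b (2 + b + C) ≡ 2 + (C + A * (2 + b + C)) + e₁₃ (suc A) b (2 + b + C)
e₀≡2+slack+e₁₃ = solve 3 (λ A b C → let a = con 1 :+ A; c = con 2 :+ b :+ C in
  b :* c :+ a :* c :+ a :* b := con 2 :+ (C :+ A :* c) :+ (b :* c :+ a :* b :+ b)) refl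

e₂₃+3≤e₁₃ : ∀ {a b c} → a < b → 2 + b ≤ c → 3 + e₂₃ a b c ≤ e₁₃ a b c
e₂₃+3≤e₁₃ {a} {b} {c} a<b 2+b≤c with B , refl ← m≤n⇒∃[o]m+o≡n a<b = begin
  3 + e₂₃ a b c              ≤⟨ +-monoˡ-≤ (e₂₃ a b c) (≤-trans (s≤s 2≤c) (m≤n*m (suc c) (suc B))) ⟩
  suc B * suc c + e₂₃ a b c  ≡⟨ e₁₃≡[1+B][1+c]+e₂₃ a B c ⟨
  e₁₃ a b c                  ∎
  where
  open ≤-Reasoning
  2≤c : 2 ≤ c
  2≤c = ≤-trans (m≤m+n 2 b) 2+b≤c

e₁₃+3≤e₁₂ : ∀ {a b c} → 1 ≤ a → 2 + b ≤ c → 3 + e₁₃ a b c ≤ e₁₂ a b c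
e₁₃+3≤e₁₂ {a} {b} {c} 1≤a 2+b≤c with C , refl ← m≤n⇒∃[o]m+o≡n 2+b≤c = begin
  3 + e₁₃ a b c                ≤⟨ +-monoˡ-≤ (e₁₃ a b c) (≤-trans (n≤1+n 3) (*-mono-≤ (s≤s 1≤a) (m≤m+n 2 C))) ⟩
  suc a * (2 + C) + e₁₃ a b c  ≡⟨ e₁₂≡[1+a][2+C]+e₁₃ a b C ⟨
  e₁₂ a b c                    ∎
  where open ≤-Reasoning

e₁₃+2≤e₀ : ∀ {a b c} → 1 ≤ a → 2 + b ≤ c → 2 + e₁₃ a b c ≤ e₀ a b c
e₁₃+2≤e₀ {suc A} {b} {c} _ 2+b≤c with C , refl ← m≤n⇒∃[o]m+o≡n 2+b≤c =
  subst (2 + e₁₃ (suc A) b c ≤_) (sym (e₀≡2+slack+e₁₃ A b C))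
        (+-monoˡ-≤ (e₁₃ (suc A) b c) (m≤m+n 2 (C + A * c)))

slack≡0⇒c≡2+ab : ∀ A b C → C + A * (2 + b + C) ≡ 0 → 2 + b + C ≡ 2 + suc A * b
slack≡0⇒c≡2+ab A b C slack≡0
  with refl ← m+n≡0⇒m≡0 C slack≡0 | inj₁ refl ← m*n≡0⇒m≡0∨n≡0 A (m+n≡0⇒n≡0 C slack≡0) = refl

e₁₃+2≡e₀⇒c≡2+ab : ∀ {a b c} → 1 ≤ a → 2 + b ≤ c → 2 + e₁₃ a b c ≡ e₀ a b c → c ≡ 2 + a * b
e₁₃+2≡e₀⇒c≡2+ab {suc A} {b} {c} _ 2+b≤c eq with C , refl ← m≤n⇒∃[o]m+o≡n 2+b≤c =
  slack≡0⇒c≡2+ab A b C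
    (sym (+-cancelˡ-≡ 2 0 _ (+-cancelʳ-≡ (e₁₃ (suc A) b c) 2 _ (trans eq (e₀≡2+slack+e₁₃ A b C)))))

∣m-n∣≡2⇔ : ∀ m n → ∣ m - n ∣ ≡ 2 ⇔ (m ≡ 2 + n ⊎ n ≡ 2 + m)
∣m-n∣≡2⇔ m n = mk⇔ to from
  where
  to : ∣ m - n ∣ ≡ 2 → m ≡ 2 + n ⊎ n ≡ 2 + m
  to eq with ≤-total m n
  ... | inj₁ m≤n with k , refl ← m≤n⇒∃[o]m+o≡n m≤n =
    inj₂ (trans (cong (m +_) (trans (sym (∣m-m+n∣≡n m k)) eq)) (+-comm m 2))
  ... | inj₂ n≤m with k , refl ← m≤n⇒∃[o]m+o≡n n≤m =
    inj₁ (trans (cong (n +_) (trans (sym (∣m-m+n∣≡n n k)) (trans (∣-∣-comm n (n + k)) eq))) (+-comm n 2))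
  from : m ≡ 2 + n ⊎ n ≡ 2 + m → ∣ m - n ∣ ≡ 2
  from (inj₁ refl) = trans (∣-∣-comm (2 + n) n) (trans (cong (∣ n -_∣) (+-comm 2 n)) (∣m-m+n∣≡n n 2))
  from (inj₂ refl) = trans (cong (∣ m -_∣) (+-comm 2 m)) (∣m-m+n∣≡n m 2)

2+x≡y⇔c≡2+d : ∀ {x y c d} → x + c ≡ y + d → 2 + x ≡ y ⇔ c ≡ 2 + d
2+x≡y⇔c≡2+d {x} {y} {c} {d} x+c≡y+d = mk⇔ to from
  where
  x+[2+d]≡2+x+d : x + (2 + d) ≡ 2 + x + d
  x+[2+d]≡2+x+d = trans (+-suc x (suc d)) (cong suc (+-suc x d))
  to : 2 + x ≡ y → c ≡ 2 + d
  to refl = +-cancelˡ-≡ x c (2 + d) (trans x+c≡y+d (sym x+[2+d]≡2+x+d))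
  from : c ≡ 2 + d → 2 + x ≡ y
  from refl = +-cancelʳ-≡ d (2 + x) y (trans (sym x+[2+d]≡2+x+d) x+c≡y+d)

∉-exponents : ∀ {a b c k} → k ≢ e₀ a b c → k ≢ e₁₂ a b c → k ≢ e₁₃ a b c → k ≢ e₂₃ a b c →
              k ∉ exponents a b c
∉-exponents k≢e₀ _     _     _     (at₀ k≡e₀)   = k≢e₀ k≡e₀
∉-exponents _    k≢e₁₂ _     _     (at₁₂ k≡e₁₂) = k≢e₁₂ k≡e₁₂
∉-exponents _    _     k≢e₁₃ _     (at₁₃ k≡e₁₃) = k≢e₁₃ k≡e₁₃
∉-exponents _    _     _     k≢e₂₃ (at₂₃ k≡e₂₃) = k≢e₂₃ k≡e₂₃

module _ {a b c} (1≤a : 1 ≤ a) (a<b : a < b) (2+b≤c : 2 + b ≤ c) where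

  private
    e₂₃≪e₁₃ : 3 + e₂₃ a b c ≤ e₁₃ a b c
    e₂₃≪e₁₃ = e₂₃+3≤e₁₃ a<b 2+b≤c
    e₁₃≪e₁₂ : 3 + e₁₃ a b c ≤ e₁₂ a b c
    e₁₃≪e₁₂ = e₁₃+3≤e₁₂ 1≤a 2+b≤c
    e₁₃≪e₀ : 2 + e₁₃ a b c ≤ e₀ a b c
    e₁₃≪e₀ = e₁₃+2≤e₀ 1≤a 2+b≤c
    e₁₃≤e₁₂ : e₁₃ a b c ≤ e₁₂ a b c
    e₁₃≤e₁₂ = ≤-trans (m≤n+m _ 3) e₁₃≪e₁₂
    e₁₃≤e₀ : e₁₃ a b c ≤ e₀ a b c
    e₁₃≤e₀ = ≤-trans (m≤n+m _ 2) e₁₃≪e₀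
    e₂₃≪e₁₂ : 3 + e₂₃ a b c ≤ e₁₂ a b c
    e₂₃≪e₁₂ = ≤-trans e₂₃≪e₁₃ e₁₃≤e₁₂
    e₂₃≪e₀ : 3 + e₂₃ a b c ≤ e₀ a b c
    e₂₃≪e₀ = ≤-trans e₂₃≪e₁₃ e₁₃≤e₀
    e₂₃≤e₁₃ : e₂₃ a b c ≤ e₁₃ a b c
    e₂₃≤e₁₃ = ≤-trans (m≤n+m _ 3) e₂₃≪e₁₃
    e₂₃≤e₁₂ : e₂₃ a b c ≤ e₁₂ a b c
    e₂₃≤e₁₂ = ≤-trans e₂₃≤e₁₃ e₁₃≤e₁₂
    e₂₃≤e₀ : e₂₃ a b c ≤ e₀ a b c
    e₂₃≤e₀ = ≤-trans e₂₃≤e₁₃ e₁₃≤e₀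
    below : ∀ {y z} → z ≤ suc y → 2 + y ≢ z
    below z≤1+y refl = <-irrefl refl z≤1+y
    above : ∀ {y z} → 3 + y ≤ z → 2 + y ≢ z
    above 3+y≤z refl = <-irrefl refl 3+y≤z
    ab≡2+c⇒ : a * b ≡ 2 + c → ∣ a * b - c ∣ ≡ 2
    ab≡2+c⇒ = Equivalence.from (∣m-n∣≡2⇔ (a * b) c) ∘ inj₁
    c≡2+ab⇒ : c ≡ 2 + a * b → ∣ a * b - c ∣ ≡ 2
    c≡2+ab⇒ = Equivalence.from (∣m-n∣≡2⇔ (a * b) c) ∘ inj₂
    2+e₀≡e₁₂⇔ : 2 + e₀ a b c ≡ e₁₂ a b c ⇔ c ≡ 2 + a * b
    2+e₀≡e₁₂⇔ = 2+x≡y⇔c≡2+d (e₀+c≡e₁₂+ab a b c)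
    2+e₁₂≡e₀⇔ : 2 + e₁₂ a b c ≡ e₀ a b c ⇔ a * b ≡ 2 + c
    2+e₁₂≡e₀⇔ = 2+x≡y⇔c≡2+d (sym (e₀+c≡e₁₂+ab a b c))

  exponents-gap : suc (e₂₃ a b c) ∉ exponents a b c × suc (e₂₃ a b c) < e₁₃ a b c
  exponents-gap = ∉-exponents {a} {b} {c} (<⇒≢ (<-≤-trans gap e₁₃≤e₀)) (<⇒≢ (<-≤-trans gap e₁₃≤e₁₂))
                                          (<⇒≢ gap) 1+n≢n
                , gap
    where
    gap : suc (e₂₃ a b c) < e₁₃ a b c
    gap = ≤-trans (n≤1+n _) e₂₃≪e₁₃

  -- Apart from e₁₃ < e₀ and the pair e₀, e₁₂, the exponents are ordered with gaps of at least 3.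
  2-apart⇒∣ab-c∣≡2 : ∀ {y} → y ∈ exponents a b c → 2 + y ∈ exponents a b c → ∣ a * b - c ∣ ≡ 2
  2-apart⇒∣ab-c∣≡2 (at₀ refl)  (at₀ eq)  = contradiction eq (below (n≤1+n _))
  2-apart⇒∣ab-c∣≡2 (at₀ refl)  (at₁₂ eq) = c≡2+ab⇒ (Equivalence.to 2+e₀≡e₁₂⇔ eq)
  2-apart⇒∣ab-c∣≡2 (at₀ refl)  (at₁₃ eq) = contradiction eq (below (m≤n⇒m≤1+n e₁₃≤e₀))
  2-apart⇒∣ab-c∣≡2 (at₀ refl)  (at₂₃ eq) = contradiction eq (below (m≤n⇒m≤1+n e₂₃≤e₀))
  2-apart⇒∣ab-c∣≡2 (at₁₂ refl) (at₀ eq)  = ab≡2+c⇒ (Equivalence.to 2+e₁₂≡e₀⇔ eq)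
  2-apart⇒∣ab-c∣≡2 (at₁₂ refl) (at₁₂ eq) = contradiction eq (below (n≤1+n _))
  2-apart⇒∣ab-c∣≡2 (at₁₂ refl) (at₁₃ eq) = contradiction eq (below (m≤n⇒m≤1+n e₁₃≤e₁₂))
  2-apart⇒∣ab-c∣≡2 (at₁₂ refl) (at₂₃ eq) = contradiction eq (below (m≤n⇒m≤1+n e₂₃≤e₁₂))
  2-apart⇒∣ab-c∣≡2 (at₁₃ refl) (at₀ eq)  = c≡2+ab⇒ (e₁₃+2≡e₀⇒c≡2+ab 1≤a 2+b≤c eq)
  2-apart⇒∣ab-c∣≡2 (at₁₃ refl) (at₁₂ eq) = contradiction eq (above e₁₃≪e₁₂)
  2-apart⇒∣ab-c∣≡2 (at₁₃ refl) (at₁₃ eq) = contradiction eq (below (n≤1+n _))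
  2-apart⇒∣ab-c∣≡2 (at₁₃ refl) (at₂₃ eq) = contradiction eq (below (m≤n⇒m≤1+n e₂₃≤e₁₃))
  2-apart⇒∣ab-c∣≡2 (at₂₃ refl) (at₀ eq)  = contradiction eq (above e₂₃≪e₀)
  2-apart⇒∣ab-c∣≡2 (at₂₃ refl) (at₁₂ eq) = contradiction eq (above e₂₃≪e₁₂)
  2-apart⇒∣ab-c∣≡2 (at₂₃ refl) (at₁₃ eq) = contradiction eq (above e₂₃≪e₁₃)
  2-apart⇒∣ab-c∣≡2 (at₂₃ refl) (at₂₃ eq) = contradiction eq (below (n≤1+n _))

  ∣ab-c∣≡2⇒gap : ∣ a * b - c ∣ ≡ 2 →
                 ∃ λ y → y ∈ exponents a b c × suc y ∉ exponents a b c × 2 + y ∈ exponents a b c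
  ∣ab-c∣≡2⇒gap eq with Equivalence.to (∣m-n∣≡2⇔ (a * b) c) eq
  ... | inj₁ ab≡2+c = let 2+e₁₂≡e₀ = Equivalence.from 2+e₁₂≡e₀⇔ ab≡2+c in
    e₁₂ a b c , at₁₂ refl ,
    ∉-exponents {a} {b} {c} (λ eq → 1+n≢n (sym (trans eq (sym 2+e₁₂≡e₀)))) 1+n≢n
                            (>⇒≢ (s≤s e₁₃≤e₁₂)) (>⇒≢ (s≤s e₂₃≤e₁₂)) ,
    at₀ 2+e₁₂≡e₀
  ... | inj₂ c≡2+ab = let 2+e₀≡e₁₂ = Equivalence.from 2+e₀≡e₁₂⇔ c≡2+ab in
    e₀ a b c , at₀ refl ,
    ∉-exponents {a} {b} {c} 1+n≢n (λ eq → 1+n≢n (sym (trans eq (sym 2+e₀≡e₁₂))))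
                            (>⇒≢ (s≤s e₁₃≤e₀)) (>⇒≢ (s≤s e₂₃≤e₀)) ,
    at₁₂ 2+e₀≡e₁₂

-- The zero divisor graph of ℤ_pqr

module ThreePrimes {p q r : ℕ} (p-prime : Prime p) (q-prime : Prime q) (r-prime : Prime r)
                   (p≢q : p ≢ q) (p≢r : p ≢ r) (q≢r : q ≢ r) where

  n : ℕ
  n = p * q * r

  private
    instance
      p≢0 : NonZero p
      p≢0 = prime⇒nonZero p-prime
      q≢0 : NonZero q
      q≢0 = prime⇒nonZero q-prime
      r≢0 : NonZero r
      r≢0 = prime⇒nonZero r-prime
    p∤q : ¬ p ∣ q
    p∤q = distinct-primes-∤ p-prime q-prime p≢q
    p∤r : ¬ p ∣ r
    p∤r = distinct-primes-∤ p-prime r-prime p≢r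
    q∤p : ¬ q ∣ p
    q∤p = distinct-primes-∤ q-prime p-prime (≢-sym p≢q)
    q∤r : ¬ q ∣ r
    q∤r = distinct-primes-∤ q-prime r-prime q≢r
    r∤p : ¬ r ∣ p
    r∤p = distinct-primes-∤ r-prime p-prime (≢-sym p≢r)
    r∤q : ¬ r ∣ q
    r∤q = distinct-primes-∤ r-prime q-prime (≢-sym q≢r)

  n∣⇔ : ∀ {v} → n ∣ v ⇔ ((p ∣ v) × (q ∣ v) × (r ∣ v))
  n∣⇔ = mk⇔ (λ n∣v → ∣-trans (∣-trans (m∣m*n q) (m∣m*n r)) n∣v , ∣-trans (n∣m*n*o p r) n∣v
                    , ∣-trans (n∣m*n (p * q)) n∣v)
            (λ (p∣v , q∣v , r∣v) → coprime⇒*∣ pq⊥r (coprime⇒*∣ p⊥q p∣v q∣v) r∣v)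
    where
    p⊥q : Coprime p q
    p⊥q = prime∤⇒coprime p-prime p∤q
    pq⊥r : Coprime (p * q) r
    pq⊥r = Coprimality.sym (prime∤⇒coprime r-prime (prime∤* r-prime r∤p r∤q))

  annihilatesᵇ : ℕ → ℕ → Bool
  annihilatesᵇ x y = (p ∣ᵇ x ∨ p ∣ᵇ y) ∧ (q ∣ᵇ x ∨ q ∣ᵇ y) ∧ (r ∣ᵇ x ∨ r ∣ᵇ y)

  n∣*⇔annihilatesᵇ : ∀ x y → n ∣ x * y ⇔ annihilatesᵇ x y ≡ true
  n∣*⇔annihilatesᵇ x y = mk⇔ to from
    where
    to : n ∣ x * y → annihilatesᵇ x y ≡ true
    to n∣xy = let p∣ , q∣ , r∣ = Equivalence.to n∣⇔ n∣xy in
      Equivalence.from ∧≡true⇔ ( Equivalence.to (prime∣*⇔ x y p-prime) p∣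
                               , Equivalence.from ∧≡true⇔ ( Equivalence.to (prime∣*⇔ x y q-prime) q∣
                                                          , Equivalence.to (prime∣*⇔ x y r-prime) r∣))
    from : annihilatesᵇ x y ≡ true → n ∣ x * y
    from bits = let p-bit , qr-bits = Equivalence.to ∧≡true⇔ bits
                    q-bit , r-bit   = Equivalence.to ∧≡true⇔ qr-bits in
      Equivalence.from n∣⇔ ( Equivalence.from (prime∣*⇔ x y p-prime) p-bit
                           , Equivalence.from (prime∣*⇔ x y q-prime) q-bit
                           , Equivalence.from (prime∣*⇔ x y r-prime) r-bit)

  residueClass : ℕ → Maybe Class
  residueClass v = classOf (p ∣ᵇ v) (q ∣ᵇ v) (r ∣ᵇ v)

  annihilatesᵇ-class : ∀ {x y τ σ} → residueClass x ≡ just τ → residueClass y ≡ just σ →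
                       annihilatesᵇ x y ≡ annihilate τ σ
  annihilatesᵇ-class {x} {y} cx cy =
    let p-x , q-x , r-x = classOf-has (p ∣ᵇ x) (q ∣ᵇ x) (r ∣ᵇ x) cx
        p-y , q-y , r-y = classOf-has (p ∣ᵇ y) (q ∣ᵇ y) (r ∣ᵇ y) cy
    in cong₂ _∧_ (cong₂ _∨_ p-x p-y) (cong₂ _∧_ (cong₂ _∨_ q-x q-y) (cong₂ _∨_ r-x r-y))

  classified⇒≢0 : ∀ {v τ} → residueClass v ≡ just τ → v ≢ 0
  classified⇒≢0 cv refl
    rewrite ∣⇒∣ᵇ≡true (p ∣0) | ∣⇒∣ᵇ≡true (q ∣0) | ∣⇒∣ᵇ≡true (r ∣0) = contradiction cv λ ()

  representative : Class → ℕ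
  representative V₁  = p
  representative V₂  = q
  representative V₃  = r
  representative V₁₂ = p * q
  representative V₁₃ = p * r
  representative V₂₃ = q * r

  residueClass-representative : ∀ τ → residueClass (representative τ) ≡ just τ
  residueClass-representative V₁
    rewrite ∣⇒∣ᵇ≡true (∣-refl {p}) | ∤⇒∣ᵇ≡false q∤p | ∤⇒∣ᵇ≡false r∤p = refl
  residueClass-representative V₂
    rewrite ∤⇒∣ᵇ≡false p∤q | ∣⇒∣ᵇ≡true (∣-refl {q}) | ∤⇒∣ᵇ≡false r∤q = refl
  residueClass-representative V₃
    rewrite ∤⇒∣ᵇ≡false p∤r | ∤⇒∣ᵇ≡false q∤r | ∣⇒∣ᵇ≡true (∣-refl {r}) = refl
  residueClass-representative V₁₂
    rewrite ∣⇒∣ᵇ≡true (m∣m*n {p} q) | ∣⇒∣ᵇ≡true (n∣m*n p {q})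
          | ∤⇒∣ᵇ≡false (prime∤* r-prime r∤p r∤q) = refl
  residueClass-representative V₁₃
    rewrite ∣⇒∣ᵇ≡true (m∣m*n {p} r) | ∤⇒∣ᵇ≡false (prime∤* q-prime q∤p q∤r)
          | ∣⇒∣ᵇ≡true (n∣m*n p {r}) = refl
  residueClass-representative V₂₃
    rewrite ∤⇒∣ᵇ≡false (prime∤* p-prime p∤q p∤r) | ∣⇒∣ᵇ≡true (m∣m*n {q} r)
          | ∣⇒∣ᵇ≡true (n∣m*n q {r}) = refl

  cofactor : Class → ℕ
  cofactor V₁  = q * r
  cofactor V₂  = p * r
  cofactor V₃  = p * q
  cofactor V₁₂ = r
  cofactor V₁₃ = q
  cofactor V₂₃ = p

  representative*cofactor : ∀ τ → representative τ * cofactor τ ≡ n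
  representative*cofactor V₁  = sym (*-assoc p q r)
  representative*cofactor V₂  = sym (xy∙z≈y∙xz p q r)
  representative*cofactor V₃  = sym (xy∙z≈z∙xy p q r)
  representative*cofactor V₁₂ = refl
  representative*cofactor V₁₃ = sym (xy∙z≈xz∙y p q r)
  representative*cofactor V₂₃ = sym (xy∙z≈yz∙x p q r)

  representative<n : ∀ τ → representative τ < n
  representative<n τ = subst (representative τ <_) (representative*cofactor τ)
                             (m<m*n (representative τ) (cofactor τ) {{representative≢0 τ}} (1<cofactor τ))
    where
    1<prime* : ∀ {x} y .{{_ : NonZero y}} → Prime x → 1 < x * y
    1<prime* {x} y px = <-≤-trans (1<prime px) (m≤m*n x y)
    representative≢0 : ∀ τ → NonZero (representative τ)
    representative≢0 V₁  = p≢0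
    representative≢0 V₂  = q≢0
    representative≢0 V₃  = r≢0
    representative≢0 V₁₂ = m*n≢0 p q
    representative≢0 V₁₃ = m*n≢0 p r
    representative≢0 V₂₃ = m*n≢0 q r
    1<cofactor : ∀ τ → 1 < cofactor τ
    1<cofactor V₁  = 1<prime* r q-prime
    1<cofactor V₂  = 1<prime* r p-prime
    1<cofactor V₃  = 1<prime* q p-prime
    1<cofactor V₁₂ = 1<prime r-prime
    1<cofactor V₁₃ = 1<prime q-prime
    1<cofactor V₂₃ = 1<prime p-prime

  open ZeroDivisorGraph n

  class : Fin n → Maybe Class
  class a = residueClass (toℕ a)

  rep : Class → Fin n
  rep τ = fromℕ< (representative<n τ)

  class-rep : ∀ τ → class (rep τ) ≡ just τ
  class-rep τ = trans (cong residueClass (toℕ-fromℕ< (representative<n τ))) (residueClass-representative τ)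

  vertex⇔classified : ∀ {a} → IsVertex a ⇔ ∃ λ τ → class a ≡ just τ
  vertex⇔classified {a} = mk⇔ to from
    where
    to : IsVertex a → ∃ λ τ → class a ≡ just τ
    to (a≢0 , b , b≢0 , n∣ab) with class a in ca
    ... | just τ  = τ , refl
    ... | nothing with classOf-nothing (p ∣ᵇ toℕ a) (q ∣ᵇ toℕ a) (r ∣ᵇ toℕ a) ca
    ...   | inj₁ (p∣a , q∣a , r∣a) =
      contradiction (multiple-below⇒0 (toℕ<n a)
                       (Equivalence.from n∣⇔ (∣ᵇ≡true⇒∣ p∣a , ∣ᵇ≡true⇒∣ q∣a , ∣ᵇ≡true⇒∣ r∣a))) a≢0
    ...   | inj₂ (p∤a , q∤a , r∤a) =
      let p∣ab , q∣ab , r∣ab = Equivalence.to n∣⇔ n∣ab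
          cancel : ∀ {x} → Prime x → x ∣ᵇ toℕ a ≡ false → x ∣ toℕ a * toℕ b → x ∣ toℕ b
          cancel px x∤a = coprime-divisor (prime∤⇒coprime px (∣ᵇ≡false⇒∤ x∤a))
      in contradiction (multiple-below⇒0 (toℕ<n b) (Equivalence.from n∣⇔
           (cancel p-prime p∤a p∣ab , cancel q-prime q∤a q∣ab , cancel r-prime r∤a r∣ab))) b≢0
    from : ∃ (λ τ → class a ≡ just τ) → IsVertex a
    from (τ , ca) = classified⇒≢0 ca , rep (complement τ) , classified⇒≢0 (class-rep (complement τ)) ,
                    Equivalence.from (n∣*⇔annihilatesᵇ _ _)
                      (trans (annihilatesᵇ-class ca (class-rep (complement τ))) (annihilate-complement τ))

  adjacent⇔ : ∀ {a b τ σ} → class a ≡ just τ → class b ≡ just σ → Adj a b ⇔ annihilate τ σ ≡ true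
  adjacent⇔ {a} {b} {τ} {σ} ca cb = mk⇔ to from
    where
    to : Adj a b → annihilate τ σ ≡ true
    to (_ , _ , _ , n∣ab) = trans (sym (annihilatesᵇ-class ca cb)) (Equivalence.to (n∣*⇔annihilatesᵇ _ _) n∣ab)
    from : annihilate τ σ ≡ true → Adj a b
    from τ~σ = Equivalence.from vertex⇔classified (τ , ca) , Equivalence.from vertex⇔classified (σ , cb) , a≢b ,
               Equivalence.from (n∣*⇔annihilatesᵇ _ _) (trans (annihilatesᵇ-class ca cb) τ~σ)
      where
      a≢b : a ≢ b
      a≢b refl with refl ← just-injective (trans (sym ca) cb) =
        contradiction (trans (sym τ~σ) (annihilate-irrefl τ)) λ ()

  open BlowUp annihilate class rep class-rep vertex⇔classified adjacent⇔

  lifts : List (Subset n)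
  lifts = map lift independentDominatingClassSets

  lifts-unique : Unique lifts
  lifts-unique = (differ-at V₃ (λ ()) ∷ differ-at V₂ (λ ()) ∷ differ-at V₁ (λ ()) ∷ [])
               ∷ (differ-at V₁₂ (λ ()) ∷ differ-at V₁₂ (λ ()) ∷ [])
               ∷ (differ-at V₁₃ (λ ()) ∷ [])
               ∷ [] ∷ []
    where
    differ-at : ∀ {X Y} τ → X τ ≢ Y τ → lift X ≢ lift Y
    differ-at τ Xτ≢Yτ eq = Xτ≢Yτ (lift-injective eq τ)

  classSize : Class → ℕ
  classSize V₁  = φ (q * r)
  classSize V₂  = φ (p * r)
  classSize V₃  = φ (p * q)
  classSize V₁₂ = φ r
  classSize V₁₃ = φ q
  classSize V₂₃ = φ p

  inClass : Class → ℕ → Bool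
  inClass τ v = inPattern τ (p ∣ᵇ v) (q ∣ᵇ v) (r ∣ᵇ v)

  private
    count-up-to : ∀ {m} {g : ℕ → Bool} → n ≡ m → count n g ≡ count m g
    count-up-to {g = g} = cong (λ k → count k g)

  count-inClass : ∀ τ → count n (inClass τ) ≡ classSize τ
  count-inClass V₁  = trans (count-up-to (*-assoc p q r))     (count-exactly-one q-prime r-prime q∤p r∤p)
  count-inClass V₂  = trans (count-up-to (xy∙z≈y∙xz p q r))   (count-exactly-one p-prime r-prime p∤q r∤q)
  count-inClass V₃  = trans (count-up-to (xy∙z≈z∙xy p q r))   (count-exactly-one p-prime q-prime p∤r q∤r)
  count-inClass V₁₂ = trans (count-up-to (*-assoc p q r))     (count-exactly-two q-prime r-prime q∤p r∤p r∤q)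
  count-inClass V₁₃ = trans (count-up-to (xy∙z≈x∙zy p q r))   (count-exactly-two r-prime q-prime r∤p q∤p q∤r)
  count-inClass V₂₃ = trans (count-up-to (xy∙z≈y∙zx p q r))   (count-exactly-two r-prime p-prime r∤q p∤q p∤r)

  ∣lift∣ : ∀ X → Subset.∣ lift X ∣ ≡ sum (map (λ τ → if X τ then classSize τ else 0) allClasses)
  ∣lift∣ X = begin
    Subset.∣ lift X ∣
      ≡⟨ ∣tabulate∘toℕ∣ n (maybe′ X false ∘ residueClass) ⟩
    count n (maybe′ X false ∘ residueClass)
      ≡⟨ sumBelow-cong n (λ {v} _ → χ-classOf X (p ∣ᵇ v) (q ∣ᵇ v) (r ∣ᵇ v)) ⟩
    sumBelow n (λ v → sum (map (λ τ → χ (inClass τ v ∧ X τ)) allClasses))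
      ≡⟨ sumBelow-sum n (λ v τ → χ (inClass τ v ∧ X τ)) allClasses ⟩
    sum (map (λ τ → count n (λ v → inClass τ v ∧ X τ)) allClasses)
      ≡⟨ cong sum (map-cong classCount allClasses) ⟩
    sum (map (λ τ → if X τ then classSize τ else 0) allClasses)
      ∎
    where
    open ≡-Reasoning
    classCount : ∀ τ → count n (λ v → inClass τ v ∧ X τ) ≡ (if X τ then classSize τ else 0)
    classCount τ = trans (count-∧-const n (inClass τ) (X τ)) (cong (λ m → if X τ then m else 0) (count-inClass τ))

  sizes≡exponents : map Subset.∣_∣ lifts ≡ exponents (φ p) (φ q) (φ r)
  sizes≡exponents = cong₂ _∷_ (sum-of-three (∣lift∣ I₀)  φ[qr] φ[pr] φ[pq])
                  ( cong₂ _∷_ (sum-of-three (∣lift∣ I₁₂) φ[qr] φ[pr] refl)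
                  ( cong₂ _∷_ (sum-of-three (∣lift∣ I₁₃) φ[qr] φ[pq] refl)
                  ( cong₂ _∷_ (sum-of-three (∣lift∣ I₂₃) φ[pr] φ[pq] refl) refl)))
    where
    φ[pq] : φ (p * q) ≡ φ p * φ q
    φ[pq] = φ-multiplicative p-prime q-prime p≢q
    φ[pr] : φ (p * r) ≡ φ p * φ r
    φ[pr] = φ-multiplicative p-prime r-prime p≢r
    φ[qr] : φ (q * r) ≡ φ q * φ r
    φ[qr] = φ-multiplicative q-prime r-prime q≢r
    sum-of-three : ∀ {s x y z x′ y′ z′} → s ≡ x + (y + (z + 0)) →
                   x ≡ x′ → y ≡ y′ → z ≡ z′ → s ≡ x′ + y′ + z′
    sum-of-three {x = x} {y} {z} s≡ refl refl refl =
      trans s≡ (trans (cong (λ w → x + (y + w)) (+-identityʳ z)) (sym (+-assoc x y z)))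

  indDomCoeff≡coeffOfExponents : ∀ k → indDomCoeff n k ≡ coeffOfPowers (exponents (φ p) (φ q) (φ r)) k
  indDomCoeff≡coeffOfExponents k =
    trans (indDomCoeff≡coeffOfPowers n lifts-unique indDom⇔∈ k) (cong (λ es → coeffOfPowers es k) sizes≡exponents)
    where
    indDom⇔∈ : ∀ S → IsIndependentDominating S ⇔ S ∈ lifts
    indDom⇔∈ = independentDominating⇔∈ classify independentDominatingClassSets-sound

proposition4 : (p q r : ℕ) → Prime p → Prime q → Prime r → p < q → q < r →
    (b : ℕ) → IsDegree (indDomCoeff (p * q * r)) b →
      ¬ Unimodal (indDomCoeff (p * q * r)) b
      × (LogConcave (indDomCoeff (p * q * r)) b ⇔ ∣ φ (p * q) - φ r ∣ ≢ 2)
proposition4 p q r p-prime q-prime r-prime p<q q<r deg degree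
  rewrite φ-multiplicative p-prime q-prime (<⇒≢ p<q) = not-unimodal , mk⇔ logConcave⇒ ⇒logConcave
  where
  open ThreePrimes p-prime q-prime r-prime (<⇒≢ p<q) (<⇒≢ (<-trans p<q q<r)) (<⇒≢ q<r)
  D≗ : indDomCoeff n ≗ coeffOfPowers (exponents (φ p) (φ q) (φ r))
  D≗ = indDomCoeff≡coeffOfExponents
  1≤a : 1 ≤ φ p
  1≤a = 1≤φ-prime p-prime
  a<b : φ p < φ q
  a<b = φ-prime-+-mono-≤ 1 p-prime q-prime p<q
  2+b≤c : 2 + φ q ≤ φ r
  2+b≤c = φ-prime-+-mono-≤ 2 q-prime r-prime (odd-primes-gap q-prime r-prime (≤-<-trans (1<prime p-prime) p<q) q<r)
  not-unimodal : ¬ Unimodal (indDomCoeff n) deg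
  not-unimodal = let gap∉ , gap< = exponents-gap 1≤a a<b 2+b≤c in
    powers-¬unimodal D≗ degree (at₂₃ refl) gap∉ gap< (at₁₃ refl)
  logConcave⇒ : LogConcave (indDomCoeff n) deg → ∣ φ p * φ q - φ r ∣ ≢ 2
  logConcave⇒ lc ∣ab-c∣≡2 = let y , y∈ , y+1∉ , y+2∈ = ∣ab-c∣≡2⇒gap 1≤a a<b 2+b≤c ∣ab-c∣≡2 in
    powers-¬logConcave D≗ degree y∈ y+1∉ y+2∈ lc
  ⇒logConcave : ∣ φ p * φ q - φ r ∣ ≢ 2 → LogConcave (indDomCoeff n) deg
  ⇒logConcave ∣ab-c∣≢2 =
    powers-logConcave D≗ deg (λ y∈ y+2∈ → ∣ab-c∣≢2 (2-apart⇒∣ab-c∣≡2 1≤a a<b 2+b≤c y∈ y+2∈))
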